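{- Let $p>3$ be a prime, $\Delta$ a nonsquare in $\mathbb{F}_p$ (so $\mathbb{F}_{p^2}=\mathbb{F}_p(\sqrt{\Delta})$), $C_{3,\Delta}(s)=2(1+s\sqrt{\Delta})$, and for $s\in\mathbb{F}_p$ let $\mathcal{E}_{3,\Delta,s}: y^2=x^3-3(2C_{3,\Delta}(s)+1)x+(C_{3,\Delta}(s)^2+10C_{3,\Delta}(s)-2)$ over $\mathbb{F}_{p^2}$. Then, as $s$ ranges over $\mathbb{F}_p$, the curves $\mathcal{E}_{3,\Delta,s}$ include at least $p-8$ pairwise non-isomorphic curves, and, counting also their quadratic twists over $\mathbb{F}_{p^2}$, at least $2p-16$ pairwise non-$\mathbb{F}_{p^2}$-isomorphic curves (each equipped with the degree-$3p$ endomorphism $\psi_{3,\Delta,s}$ or its twist).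
   Context: $\psi_{3,\Delta,s}$ denotes the endomorphism $(x,y)\mapsto\left(-\frac{x^p}{3}-\frac{4C_{3,\Delta}(s)^p}{x^p-3}-\frac{4C_{3,\Delta}(s)^{2p}}{3(x^p-3)^2},\ \frac{y^p}{\sqrt{ -3}}\left(\frac{ -1}{3}+\frac{4C_{3,\Delta}(s)^p}{(x^p-3)^2}+\frac{8C_{3,\Delta}(s)^{2p}}{3(x^p-3)^3}\right)\right)$ of $\mathcal{E}_{3,\Delta,s}$. The quadratic twist of a curve over $\mathbb{F}_{p^2}$ is its twist by a nonsquare of $\mathbb{F}_{p^2}$. -}

module Defs where

open import Data.Nat using (ℕ; zero; suc; _+_; _*_; _∸_; NonZero)
open import Data.Nat.DivMod using (_mod_)
open import Data.Fin using (Fin; toℕ)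
open import Data.Product using (Σ; _×_; _,_; proj₁; proj₂)
open import Data.Bool using (Bool; true; false)
open import Relation.Binary.PropositionalEquality using (_≡_; _≢_)
open import Relation.Nullary using (¬_)

-- Arithmetic in F_p (elements: Fin p) and F_{p^2} = F_p(√Δ)
-- (elements: pairs (a , b) : Fin p × Fin p standing for a + b√Δ).
module Field (p : ℕ) {{_ : NonZero p}} (Δ : Fin p) where

  Fp : Set
  Fp = Fin p

  litp : ℕ → Fp
  litp n = n mod p

  _+p_ : Fp → Fp → Fp
  a +p b = (toℕ a + toℕ b) mod p

  _*p_ : Fp → Fp → Fp
  a *p b = (toℕ a * toℕ b) mod p

  negp : Fp → Fp
  negp a = (p ∸ toℕ a) mod p

  NonsquareFp : Set
  NonsquareFp = ¬ (Σ Fp λ x → x *p x ≡ Δ)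

  F2 : Set
  F2 = Fp × Fp

  lit : ℕ → F2
  lit n = (litp n , litp 0)

  _+_F : F2 → F2 → F2
  (a , b) + (c , d) F = (a +p c , b +p d)

  _*F_ : F2 → F2 → F2
  (a , b) *F (c , d) = ((a *p c) +p ((b *p d) *p Δ) , (a *p d) +p (b *p c))

  negF : F2 → F2
  negF (a , b) = (negp a , negp b)

  _+F_ : F2 → F2 → F2
  x +F y = x + y F

  _-F_ : F2 → F2 → F2
  x -F y = x +F negF y

  sq cube : F2 → F2
  sq x = x *F x
  cube x = x *F sq x

  NonsquareF2 : F2 → Set
  NonsquareF2 d = ¬ (Σ F2 λ x → x *F x ≡ d)

  -- short Weierstrass curve y^2 = x^3 + a x + b, given by (a , b)
  Curve : Set
  Curve = F2 × F2

  Nonsingular : Curve → Set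
  Nonsingular (a , b) = (lit 4 *F cube a) +F (lit 27 *F sq b) ≢ lit 0

  -- F_{p^2}-isomorphism of short Weierstrass curves (char > 3):
  -- admissible change of variables (x , y) ↦ (u^2 x , u^3 y), u ∈ F_{p^2}^*,
  -- i.e. a' = u^4 a and b' = u^6 b.
  Isomorphic : Curve → Curve → Set
  Isomorphic (a , b) (a' , b') =
    Σ F2 λ u → (u ≢ lit 0) × (a' ≡ sq (sq u) *F a) × (b' ≡ cube (sq u) *F b)

  twist : F2 → Curve → Curve
  twist d (a , b) = (sq d *F a , cube d *F b)

  C3 : Fp → F2
  C3 s = (litp 2 , litp 2 *p s)

  E3 : Fp → Curve
  E3 s = ( negF (lit 3 *F ((lit 2 *F C3 s) +F lit 1))
         , (sq (C3 s) +F (lit 10 *F C3 s)) -F lit 2 )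

  E3orTwist : F2 → Fp × Bool → Curve
  E3orTwist d (s , false) = E3 s
  E3orTwist d (s , true) = twist d (E3 s)

{-# OPTIONS --safe #-}
-- Two short Weierstrass curves y² = x³ + ax + b over F_p² are isomorphic only if a'³b² = a³b'²,
-- and a quadratic twist multiplies both sides by the same power of d. Writing F_p² = F_p(√Δ)
-- and lifting coordinates to ℤ, for E3 s and E3 t this identity becomes 432 (s − t) (Δ σ κ + √Δ ε) = 0
-- with σ = s + t and π = stΔ, so j(E3 s) = j(E3 t), s ≠ t, forces σ κ(σ²Δ, π) = ε(σ²Δ, π) = 0 mod p.
-- Eliminating, π is a root of one of five linear polynomials and σ is then fixed up to sign;
-- thus the unordered pairs {s , t} with equal j-invariant fall into at most 8 classes, each a
-- single pair.  Dropping the larger element of each pair (and s = 0 when p = 11, where b vanishes)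
-- leaves at least p − 8 curves with distinct j-invariants. Twisting keeps them distinct from
-- each other, and E3 s is not isomorphic to its own twist because a ≠ 0 ≠ b would make d a square.
-- For p < 11 the bounds are vacuous.

module Submission where

open import Data.Nat using (ℕ; NonZero; _≤_)
open import Data.Nat.Primality using (Prime)
open import Data.Fin using (Fin)
open import Defs

module Counting where

  open import Data.Fin using (Fin; punchOut)
  open import Data.Fin.Properties using (punchOut-injective)
  open import Data.List using (List; []; _∷_; length; filter)
  open import Data.List.Relation.Unary.All using (All; []; _∷_; reduce)
  open import Data.List.Relation.Unary.AllPairs using (AllPairs; []; _∷_)
  open import Data.List.Relation.Unary.Unique.Propositional using (Unique)
  open import Data.Nat using (zero; suc; _+_; _≤_; z≤n; s≤s)
  open import Data.Nat.Properties using (+-suc)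
  open import Level using (Level)
  open import Relation.Binary.PropositionalEquality using (_≡_; _≢_; refl; cong; trans; subst)
  open import Relation.Nullary using (yes; no)
  open import Relation.Unary using (Pred; Decidable)
  open import Relation.Unary.Properties using (∁?)

  private
    variable
      a b ℓ : Level
      A B : Set a

  module _ {P : Pred A ℓ} (f : ∀ {x} → P x → B) where

    length-reduce : ∀ {xs} (pxs : All P xs) → length (reduce f pxs) ≡ length xs
    length-reduce [] = refl
    length-reduce (_ ∷ pxs) = cong suc (length-reduce pxs)

    module _ (f-injective : ∀ {x y} (px : P x) (py : P y) → f px ≡ f py → x ≡ y) where

      private
        reduce-≢ : ∀ {x xs} (px : P x) (pxs : All P xs) → All (x ≢_) xs → All (f px ≢_) (reduce f pxs)
        reduce-≢ px [] [] = []
        reduce-≢ px (py ∷ pxs) (x≢y ∷ x≢xs) = (λ eq → x≢y (f-injective px py eq)) ∷ reduce-≢ px pxs x≢xs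

      reduce-Unique : ∀ {xs} (pxs : All P xs) → Unique xs → Unique (reduce f pxs)
      reduce-Unique [] [] = []
      reduce-Unique (px ∷ pxs) (x≢xs ∷ u) = reduce-≢ px pxs x≢xs ∷ reduce-Unique pxs u

  Unique⇒length≤ : ∀ {n} {xs : List (Fin n)} → Unique xs → length xs ≤ n
  Unique⇒length≤ {zero} {[]} _ = z≤n
  Unique⇒length≤ {zero} {() ∷ _} _
  Unique⇒length≤ {suc n} {[]} _ = z≤n
  Unique⇒length≤ {suc n} {x ∷ xs} (x≢xs ∷ u) =
    s≤s (subst (_≤ n) (length-reduce punchOut x≢xs)
      (Unique⇒length≤ (reduce-Unique punchOut punchOut-injective x≢xs u)))

  Unique∧injective⇒length≤ : ∀ {n} {P : Pred A ℓ} (f : ∀ {x} → P x → Fin n) →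
                             (∀ {x y} (px : P x) (py : P y) → f px ≡ f py → x ≡ y) →
                             ∀ {xs} → All P xs → Unique xs → length xs ≤ n
  Unique∧injective⇒length≤ {n = n} f f-injective pxs u =
    subst (_≤ n) (length-reduce f pxs) (Unique⇒length≤ (reduce-Unique f f-injective pxs u))

  module _ {P : Pred A ℓ} {R S : A → A → Set ℓ} (R⇒S : ∀ {x y} → P x → P y → R x y → S x y) where

    private
      All-map : ∀ {x xs} → P x → All P xs → All (R x) xs → All (S x) xs
      All-map px [] [] = []
      All-map px (py ∷ pxs) (r ∷ rs) = R⇒S px py r ∷ All-map px pxs rs

    AllPairs-map-All : ∀ {xs} → All P xs → AllPairs R xs → AllPairs S xs
    AllPairs-map-All [] [] = []
    AllPairs-map-All (px ∷ pxs) (rs ∷ rss) = All-map px pxs rs ∷ AllPairs-map-All pxs rss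

  module _ {P : Pred A ℓ} (P? : Decidable P) where

    length-filter+length-filter-∁ : ∀ xs → length (filter P? xs) + length (filter (∁? P?) xs) ≡ length xs
    length-filter+length-filter-∁ [] = refl
    length-filter+length-filter-∁ (x ∷ xs) with P? x
    ... | yes _ = cong suc (length-filter+length-filter-∁ xs)
    ... | no _ = trans (+-suc (length (filter P? xs)) _) (cong suc (length-filter+length-filter-∁ xs))

module Congruence (p : ℕ) {{_ : NonZero p}} where

  open import Data.Empty using (⊥-elim)
  open import Data.Fin using (Fin; toℕ)
  import Data.Fin.Properties as Fin
  open import Data.Integer using (ℤ; +_; 0ℤ; 1ℤ; _+_; _*_; -_; _-_; ∣_∣)
  open import Data.Integer.Divisibility.Signed using (_∣_; divides; _∣?_; ∣m∣n⇒∣m+n; ∣m⇒∣-m; ∣m⇒∣m*n; ∣n⇒∣m*n; ∣⇒∣ᵤ; ∣ᵤ⇒∣)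
  import Data.Integer.Properties as ℤ
  open import Data.Integer.Tactic.RingSolver using (solve-∀)
  open import Data.Nat as ℕ using (ℕ; suc)
  open import Data.Nat.Coprimality using (prime⇒coprime; coprime-Bézout)
  open import Data.Nat.DivMod using (_mod_; _divMod_; module DivMod; m<n⇒m%n≡m)
  import Data.Nat.Divisibility as ℕ
  open import Data.Nat.Divisibility using (n∣m⇒m%n≡0)
  open import Data.Nat.GCD using (module Bézout)
  open import Data.Nat.Primality using (Prime; euclidsLemma)
  import Data.Nat.Properties as ℕ
  open import Data.Product using (Σ; _,_)
  open import Data.Sum as Sum using (_⊎_; inj₁; inj₂; [_,_]′)
  open import Function using (_∘_; id)
  open import Relation.Binary.PropositionalEquality using (_≡_; refl; sym; trans; cong; subst; module ≡-Reasoning)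
  open import Relation.Nullary using (¬_; Dec)
  import Relation.Nullary.Decidable as Dec

  infix 4 _≈_ _≉_

  record _≈_ (a b : ℤ) : Set where
    constructor ∣⇒≈
    field ≈⇒∣ : + p ∣ a - b
  open _≈_ public

  _≉_ : ℤ → ℤ → Set
  a ≉ b = ¬ a ≈ b

  private
    ≈-by : ∀ {a b} c → a - b ≡ c → + p ∣ c → a ≈ b
    ≈-by c eq p∣c = ∣⇒≈ (subst (+ p ∣_) (sym eq) p∣c)

  ≈-refl : ∀ {a} → a ≈ a
  ≈-refl {a} = ≈-by (0ℤ * + p) (ℤ.+-inverseʳ a) (divides 0ℤ refl)

  ≈-sym : ∀ {a b} → a ≈ b → b ≈ a
  ≈-sym {a} {b} (∣⇒≈ h) = ≈-by (- (a - b)) (difference-swap a b) (∣m⇒∣-m h)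
    where
    difference-swap : ∀ a b → b - a ≡ - (a - b)
    difference-swap = solve-∀

  ≈-trans : ∀ {a b c} → a ≈ b → b ≈ c → a ≈ c
  ≈-trans {a} {b} {c} (∣⇒≈ h) (∣⇒≈ k) = ≈-by _ (telescope a b c) (∣m∣n⇒∣m+n h k)
    where
    telescope : ∀ a b c → a - c ≡ (a - b) + (b - c)
    telescope = solve-∀

  ≈-reflexive : ∀ {a b} → a ≡ b → a ≈ b
  ≈-reflexive refl = ≈-refl

  +-cong : ∀ {a b c d} → a ≈ c → b ≈ d → a + b ≈ c + d
  +-cong {a} {b} {c} {d} (∣⇒≈ h) (∣⇒≈ k) = ≈-by _ (interchange a b c d) (∣m∣n⇒∣m+n h k)
    where
    interchange : ∀ a b c d → (a + b) - (c + d) ≡ (a - c) + (b - d)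
    interchange = solve-∀

  *-cong : ∀ {a b c d} → a ≈ c → b ≈ d → a * b ≈ c * d
  *-cong {a} {b} {c} {d} (∣⇒≈ h) (∣⇒≈ k) =
    ≈-by _ (product-difference a b c d) (∣m∣n⇒∣m+n (∣m⇒∣m*n b h) (∣n⇒∣m*n c k))
    where
    product-difference : ∀ a b c d → (a * b) - (c * d) ≡ (a - c) * b + c * (b - d)
    product-difference = solve-∀

  -‿cong : ∀ {a b} → a ≈ b → - a ≈ - b
  -‿cong {a} {b} (∣⇒≈ h) = ≈-by _ (neg-difference a b) (∣m⇒∣-m h)
    where
    neg-difference : ∀ a b → (- a) - (- b) ≡ - (a - b)
    neg-difference = solve-∀

  -≈0⇒≈ : ∀ {a b} → a - b ≈ 0ℤ → a ≈ b
  -≈0⇒≈ {a} {b} (∣⇒≈ h) = ≈-by _ (sym (ℤ.+-identityʳ (a - b))) h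

  ≈⇒-≈0 : ∀ {a b} → a ≈ b → a - b ≈ 0ℤ
  ≈⇒-≈0 {a} {b} (∣⇒≈ h) = ≈-by _ (ℤ.+-identityʳ (a - b)) h

  *-zeroʳ-≈ : ∀ c {a} → a ≈ 0ℤ → c * a ≈ 0ℤ
  *-zeroʳ-≈ c {a} a≈0 = subst (c * a ≈_) (ℤ.*-zeroʳ c) (*-cong (≈-refl {c}) a≈0)

  ≈0-by : ∀ {a b} → a ≡ b → b ≈ 0ℤ → a ≈ 0ℤ
  ≈0-by eq = subst (_≈ 0ℤ) (sym eq)

  combination≈0 : ∀ {x y} a b → x ≈ 0ℤ → y ≈ 0ℤ → a * x + b * y ≈ 0ℤ
  combination≈0 a b x≈0 y≈0 = +-cong (*-zeroʳ-≈ a x≈0) (*-zeroʳ-≈ b y≈0)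

  ≈? : ∀ a b → Dec (a ≈ b)
  ≈? a b = Dec.map′ ∣⇒≈ ≈⇒∣ (+ p ∣? (a - b))

  ≈0⇒p∣∣∣ : ∀ {a} → a ≈ 0ℤ → p ℕ.∣ ∣ a ∣
  ≈0⇒p∣∣∣ {a} (∣⇒≈ h) = ∣⇒∣ᵤ (subst (+ p ∣_) (ℤ.+-identityʳ a) h)

  p∣∣∣⇒≈0 : ∀ {a} → p ℕ.∣ ∣ a ∣ → a ≈ 0ℤ
  p∣∣∣⇒≈0 {a} h = ∣⇒≈ (subst (+ p ∣_) (sym (ℤ.+-identityʳ a)) (∣ᵤ⇒∣ h))

  +-mod : ∀ n → + toℕ (n mod p) ≈ + n
  +-mod n = subst (+ r ≈_) (sym n≡r+q*p)
    (≈-by ((- + q) * + p) (remainder-difference (+ r) (+ q) (+ p)) (divides (- + q) refl))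
    where
    open DivMod (n divMod p) using (property) renaming (quotient to q)
    r = toℕ (n mod p)
    n≡r+q*p : + n ≡ + r + + q * + p
    n≡r+q*p = trans (cong +_ property) (trans (ℤ.pos-+ r (q ℕ.* p)) (cong (_+_ (+ r)) (ℤ.pos-* q p)))
    remainder-difference : ∀ r q p → r - (r + q * p) ≡ (- q) * p
    remainder-difference = solve-∀

  private
    <p∧p∣⇒≡0 : ∀ {k} → k ℕ.< p → p ℕ.∣ k → k ≡ 0
    <p∧p∣⇒≡0 {k} k<p p∣k = trans (sym (m<n⇒m%n≡m k<p)) (n∣m⇒m%n≡0 k p p∣k)

    ≤∧<p∧≈⇒≡ : ∀ {m n} → m ℕ.≤ n → n ℕ.< p → + m ≈ + n → m ≡ n
    ≤∧<p∧≈⇒≡ {m} {n} m≤n n<p m≈n = ℕ.≤-antisym m≤n (ℕ.m∸n≡0⇒m≤n (<p∧p∣⇒≡0 n∸m<p p∣n∸m))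
      where
      n∸m<p : n ℕ.∸ m ℕ.< p
      n∸m<p = ℕ.≤-<-trans (ℕ.m∸n≤m n m) n<p
      p∣n∸m : p ℕ.∣ n ℕ.∸ m
      p∣n∸m = subst (p ℕ.∣_) (trans (cong ∣_∣ (ℤ.m-n≡m⊖n m n)) (ℤ.∣⊖∣-≤ m≤n)) (≈0⇒p∣∣∣ (≈⇒-≈0 m≈n))

  small≉0 : ∀ k → 0 ℕ.< k → k ℕ.< p → + k ≉ 0ℤ
  small≉0 (suc k) _ k<p k≈0 with () ← <p∧p∣⇒≡0 k<p (≈0⇒p∣∣∣ k≈0)

  p≈0 : + p ≈ 0ℤ
  p≈0 = ≈-by (1ℤ * + p) (trans (ℤ.+-identityʳ (+ p)) (sym (ℤ.*-identityˡ (+ p)))) (divides 1ℤ refl)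

  -- Opaque: unfolded, integer arithmetic on lifts computes with the unary toℕ and type checking blows up.
  opaque
    toℤ : Fin p → ℤ
    toℤ x = + toℕ x

    toℤ-≡ : ∀ x → toℤ x ≡ + toℕ x
    toℤ-≡ x = refl

    toℤ-injective : ∀ {x y} → toℤ x ≈ toℤ y → x ≡ y
    toℤ-injective {x} {y} x≈y with ℕ.≤-total (toℕ x) (toℕ y)
    ... | inj₁ x≤y = Fin.toℕ-injective (≤∧<p∧≈⇒≡ x≤y (Fin.toℕ<n y) x≈y)
    ... | inj₂ y≤x = sym (Fin.toℕ-injective (≤∧<p∧≈⇒≡ y≤x (Fin.toℕ<n x) (≈-sym x≈y)))

  module IntegralDomain (p-prime : Prime p) where

    *≈0⇒≈0⊎≈0 : ∀ a b → a * b ≈ 0ℤ → a ≈ 0ℤ ⊎ b ≈ 0ℤ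
    *≈0⇒≈0⊎≈0 a b ab≈0 =
      Sum.map p∣∣∣⇒≈0 p∣∣∣⇒≈0 (euclidsLemma ∣ a ∣ ∣ b ∣ p-prime (subst (p ℕ.∣_) (ℤ.abs-* a b) (≈0⇒p∣∣∣ ab≈0)))

    a²≈0⇒a≈0 : ∀ {a} → a * a ≈ 0ℤ → a ≈ 0ℤ
    a²≈0⇒a≈0 {a} a²≈0 = [ id , id ]′ (*≈0⇒≈0⊎≈0 a a a²≈0)

    infixl 7 _*≉0_
    _*≉0_ : ∀ {a b} → a ≉ 0ℤ → b ≉ 0ℤ → a * b ≉ 0ℤ
    _*≉0_ {a} {b} a≉0 b≉0 ab≈0 = [ a≉0 , b≉0 ]′ (*≈0⇒≈0⊎≈0 a b ab≈0)

    *-cancelˡ-≈0 : ∀ {c a} → c ≉ 0ℤ → c * a ≈ 0ℤ → a ≈ 0ℤ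
    *-cancelˡ-≈0 {c} {a} c≉0 ca≈0 = [ ⊥-elim ∘ c≉0 , id ]′ (*≈0⇒≈0⊎≈0 c a ca≈0)

    -‿≉0 : ∀ {a} → a ≉ 0ℤ → - a ≉ 0ℤ
    -‿≉0 {a} a≉0 -a≈0 = a≉0 (subst (_≈ 0ℤ) (ℤ.neg-involutive a) (-‿cong -a≈0))

    private
      pos-linear : ∀ {c b k a m} → c ℕ.+ b ℕ.* k ≡ a ℕ.* m → + c + + b * + k ≡ + a * + m
      pos-linear {c} {b} {k} {a} {m} eq = begin
        + c + + b * + k      ≡⟨ cong (_+_ (+ c)) (ℤ.pos-* b k) ⟨
        + (c ℕ.+ b ℕ.* k)    ≡⟨ cong +_ eq ⟩
        + (a ℕ.* m)          ≡⟨ ℤ.pos-* a m ⟩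
        + a * + m            ∎
        where open ≡-Reasoning

    invertible : ∀ k → 0 ℕ.< k → k ℕ.< p → Σ ℤ λ z → + k * z ≈ 1ℤ
    invertible k@(suc _) _ k<p with coprime-Bézout (prime⇒coprime p-prime k<p)
    ... | Bézout.+- a b eq =
      - + b , ≈-by _ (negated (+ k) (+ b) (+ a) (+ p) (pos-linear {1} {b} {k} {a} {p} eq)) (divides (- + a) refl)
      where
      negated : ∀ k b a p → 1ℤ + b * k ≡ a * p → k * (- b) - 1ℤ ≡ (- a) * p
      negated k b a p eq = trans (rearrange k b) (trans (cong -_ eq) (ℤ.neg-distribˡ-* a p))
        where
        rearrange : ∀ k b → k * (- b) - 1ℤ ≡ - (1ℤ + b * k)
        rearrange = solve-∀
    ... | Bézout.-+ a b eq =
      + b , ≈-by _ (shifted (+ k) (+ b) (+ a) (+ p) (pos-linear {1} {a} {p} {b} {k} eq)) (divides (+ a) refl)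
      where
      shifted : ∀ k b a p → 1ℤ + a * p ≡ b * k → k * b - 1ℤ ≡ a * p
      shifted k b a p eq = trans (cong (_- 1ℤ) (trans (ℤ.*-comm k b) (sym eq))) (cancel a p)
        where
        cancel : ∀ a p → 1ℤ + a * p - 1ℤ ≡ a * p
        cancel = solve-∀

    toℤ-invertible : ∀ x → toℤ x ≉ 0ℤ → Σ ℤ λ z → toℤ x * z ≈ 1ℤ
    toℤ-invertible x x≉0 =
      subst (λ a → Σ ℤ λ z → a * z ≈ 1ℤ) (sym (toℤ-≡ x)) (invertible (toℕ x) 0<x (Fin.toℕ<n x))
      where
      0<x : 0 ℕ.< toℕ x
      0<x = ℕ.n≢0⇒n>0 (λ x≡0 → x≉0 (≈-reflexive (trans (toℤ-≡ x) (cong +_ x≡0))))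

module Lifting (p : ℕ) {{_ : NonZero p}} (Δ : Fin p) where

  open import Algebra.Bundles.Raw using (RawRing)
  open import Data.Fin using (Fin; toℕ)
  import Data.Fin.Properties as Fin
  open import Data.Integer using (ℤ; +_; -[1+_]; 0ℤ; _+_; _*_; -_; _-_)
  import Data.Integer.Properties as ℤ
  open import Data.Integer.Tactic.RingSolver using (ring)
  open import Data.Nat as ℕ using (ℕ; zero; suc)
  import Data.Nat.Properties as ℕ
  open import Data.Product using (_×_; _,_; proj₁; proj₂)
  open import Data.Vec as Vec using (Vec; _∷_; [])
  open import Data.Vec.N-ary using (N-ary; Eq; curryⁿ; curryⁿ-cong)
  import Data.Vec.Properties as Vec
  open import Relation.Binary.PropositionalEquality using (_≡_; refl; sym; trans; cong; cong₂; subst; subst₂)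
  open import Tactic.RingSolver.Core.AlmostCommutativeRing using (AlmostCommutativeRing)
  open import Tactic.RingSolver.Core.Expression using (Expr; Κ; Ι; _⊕_; _⊗_; _⊛_; ⊝_; module Eval)
  import Tactic.RingSolver.Core.Polynomial.Semantics as Semantics
  import Tactic.RingSolver.NonReflective as NonReflective

  open Field p Δ
  open Congruence p

  module ℤ-Solver = NonReflective.Ops ring

  ⟦_⟧ℤ : ∀ {n} → Expr ℤ n → Vec ℤ n → ℤ
  ⟦_⟧ℤ = ℤ-Solver.⟦_⟧

  norm-sound : ∀ {n} (e₁ e₂ : Expr ℤ n) → ℤ-Solver.norm e₁ ≡ ℤ-Solver.norm e₂ → ∀ ρ → ⟦ e₁ ⟧ℤ ρ ≡ ⟦ e₂ ⟧ℤ ρ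
  norm-sound e₁ e₂ eq ρ = begin
    ⟦ e₁ ⟧ℤ ρ                        ≡⟨ ℤ-Solver.correct e₁ ρ ⟨
    ⟦ ℤ-Solver.norm e₁ ⟧ₙ ρ          ≡⟨ cong (λ e → ⟦ e ⟧ₙ ρ) eq ⟩
    ⟦ ℤ-Solver.norm e₂ ⟧ₙ ρ          ≡⟨ ℤ-Solver.correct e₂ ρ ⟩
    ⟦ e₂ ⟧ℤ ρ                        ∎
    where
    open Relation.Binary.PropositionalEquality.≡-Reasoning
    open Semantics ℤ-Solver.homo renaming (⟦_⟧ to ⟦_⟧ₙ)

  -- Like the solver's own solve, but the hypothesis compares normal forms syntactically, which
  -- refl checks much faster than equality of their evaluations.
  solve : ∀ n (f : N-ary n (Expr ℤ n) (Expr ℤ n × Expr ℤ n)) →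
          ℤ-Solver.norm (proj₁ (ℤ-Solver.close n f)) ≡ ℤ-Solver.norm (proj₂ (ℤ-Solver.close n f)) →
          Eq n _≡_ (curryⁿ ⟦ proj₁ (ℤ-Solver.close n f) ⟧ℤ) (curryⁿ ⟦ proj₂ (ℤ-Solver.close n f) ⟧ℤ)
  solve n f eq = curryⁿ-cong _≡_ _ _ (norm-sound (proj₁ (ℤ-Solver.close n f)) (proj₂ (ℤ-Solver.close n f)) eq)

  opaque
    unfolding toℤ

    toℤ-litp : ∀ n → toℤ (litp n) ≈ + n
    toℤ-litp = +-mod

    toℤ-+p : ∀ a b → toℤ (a +p b) ≈ toℤ a + toℤ b
    toℤ-+p a b = subst (toℤ (a +p b) ≈_) (ℤ.pos-+ (toℕ a) (toℕ b)) (+-mod (toℕ a ℕ.+ toℕ b))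

    toℤ-*p : ∀ a b → toℤ (a *p b) ≈ toℤ a * toℤ b
    toℤ-*p a b = subst (toℤ (a *p b) ≈_) (ℤ.pos-* (toℕ a) (toℕ b)) (+-mod (toℕ a ℕ.* toℕ b))

    toℤ-negp : ∀ a → toℤ (negp a) ≈ - toℤ a
    toℤ-negp a = ≈-trans (+-mod (p ℕ.∸ toℕ a))
      (subst₂ _≈_ p-a≡p∸a (ℤ.+-identityˡ (- toℤ a)) (+-cong p≈0 (≈-refl { - toℤ a})))
      where
      p-a≡p∸a : + p - toℤ a ≡ + (p ℕ.∸ toℕ a)
      p-a≡p∸a = trans (ℤ.m-n≡m⊖n p (toℕ a)) (ℤ.⊖-≥ (ℕ.<⇒≤ (Fin.toℕ<n a)))

  Fp-rawRing : RawRing _ _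
  Fp-rawRing = record
    { Carrier = Fp ; _≈_ = _≡_ ; _+_ = _+p_ ; _*_ = _*p_ ; -_ = negp ; 0# = litp 0 ; 1# = litp 1 }

  fromℤ : ℤ → Fp
  fromℤ (+ n) = litp n
  fromℤ -[1+ n ] = negp (litp (suc n))

  toℤ-fromℤ : ∀ z → toℤ (fromℤ z) ≈ z
  toℤ-fromℤ (+ n) = toℤ-litp n
  toℤ-fromℤ -[1+ n ] = ≈-trans (toℤ-negp (litp (suc n))) (-‿cong (toℤ-litp (suc n)))

  open Eval Fp-rawRing fromℤ renaming (⟦_⟧ to ⟦_⟧ₚ) public

  toℤ-⟦⟧ₚ : ∀ {n} (e : Expr ℤ n) (ρ : Vec Fp n) → toℤ (⟦ e ⟧ₚ ρ) ≈ ⟦ e ⟧ℤ (Vec.map toℤ ρ)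
  toℤ-⟦⟧ₚ (Κ z) ρ = toℤ-fromℤ z
  toℤ-⟦⟧ₚ (Ι i) ρ = ≈-reflexive (sym (Vec.lookup-map i toℤ ρ))
  toℤ-⟦⟧ₚ (e ⊕ f) ρ = ≈-trans (toℤ-+p (⟦ e ⟧ₚ ρ) (⟦ f ⟧ₚ ρ)) (+-cong (toℤ-⟦⟧ₚ e ρ) (toℤ-⟦⟧ₚ f ρ))
  toℤ-⟦⟧ₚ (e ⊗ f) ρ = ≈-trans (toℤ-*p (⟦ e ⟧ₚ ρ) (⟦ f ⟧ₚ ρ)) (*-cong (toℤ-⟦⟧ₚ e ρ) (toℤ-⟦⟧ₚ f ρ))
  toℤ-⟦⟧ₚ (⊝ e) ρ = ≈-trans (toℤ-negp _) (-‿cong (toℤ-⟦⟧ₚ e ρ))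
  toℤ-⟦⟧ₚ (e ⊛ i) ρ = power i (toℤ-⟦⟧ₚ e ρ)
    where
    open import Algebra.Definitions.RawSemiring (RawRing.rawSemiring Fp-rawRing) using () renaming (_^′_ to _^ₚ_)
    open import Algebra.Definitions.RawSemiring (AlmostCommutativeRing.rawSemiring ring) using () renaming (_^′_ to _^ℤ_)
    power : ∀ i {a z} → toℤ a ≈ z → toℤ (a ^ₚ i) ≈ z ^ℤ i
    power zero _ = toℤ-litp 1
    power (suc zero) a≈z = a≈z
    power (suc (suc i)) {a} a≈z = ≈-trans (toℤ-*p (a ^ₚ suc i) a) (*-cong (power (suc i) a≈z) a≈z)

  D : ℤ
  D = toℤ Δ

  infix 4 _≈₂_
  _≈₂_ : F2 → ℤ × ℤ → Set
  u ≈₂ z = (toℤ (proj₁ u) ≈ proj₁ z) × (toℤ (proj₂ u) ≈ proj₂ z)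

  toℤ₂ : F2 → ℤ × ℤ
  toℤ₂ (a , b) = toℤ a , toℤ b

  ≈₂-toℤ₂ : ∀ u → u ≈₂ toℤ₂ u
  ≈₂-toℤ₂ u = ≈-refl , ≈-refl

  ≈₂-lit0 : lit 0 ≈₂ (0ℤ , 0ℤ)
  ≈₂-lit0 = toℤ-litp 0 , toℤ-litp 0

  ≈₂-unique : ∀ {u v z} → u ≈₂ z → v ≈₂ z → u ≡ v
  ≈₂-unique (u₁≈ , u₂≈) (v₁≈ , v₂≈) =
    cong₂ _,_ (toℤ-injective (≈-trans u₁≈ (≈-sym v₁≈))) (toℤ-injective (≈-trans u₂≈ (≈-sym v₂≈)))

  ≈₂-≡ : ∀ {u v z w} → u ≡ v → u ≈₂ z → v ≈₂ w → (proj₁ z ≈ proj₁ w) × (proj₂ z ≈ proj₂ w)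
  ≈₂-≡ refl (u₁≈ , u₂≈) (v₁≈ , v₂≈) = ≈-trans (≈-sym u₁≈) v₁≈ , ≈-trans (≈-sym u₂≈) v₂≈

  _⊕√_ _⊗√_ : ℤ × ℤ → ℤ × ℤ → ℤ × ℤ
  (x₁ , x₂) ⊕√ (y₁ , y₂) = x₁ + y₁ , x₂ + y₂
  (x₁ , x₂) ⊗√ (y₁ , y₂) = x₁ * y₁ + x₂ * y₂ * D , x₁ * y₂ + x₂ * y₁

  ⊝√_ : ℤ × ℤ → ℤ × ℤ
  ⊝√ (x₁ , x₂) = - x₁ , - x₂

  +F-≈₂ : ∀ {u v} x y → u ≈₂ x → v ≈₂ y → u +F v ≈₂ x ⊕√ y
  +F-≈₂ {u} {v} _ _ (u₁≈ , u₂≈) (v₁≈ , v₂≈) =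
    ≈-trans (toℤ-+p (proj₁ u) (proj₁ v)) (+-cong u₁≈ v₁≈) , ≈-trans (toℤ-+p (proj₂ u) (proj₂ v)) (+-cong u₂≈ v₂≈)

  *F-≈₂ : ∀ {u v} x y → u ≈₂ x → v ≈₂ y → u *F v ≈₂ x ⊗√ y
  *F-≈₂ {a , b} {c , d} _ _ (a≈ , b≈) (c≈ , d≈) =
    ≈-trans (toℤ-+p (a *p c) ((b *p d) *p Δ))
      (+-cong (≈-trans (toℤ-*p a c) (*-cong a≈ c≈))
              (≈-trans (toℤ-*p (b *p d) Δ) (*-cong (≈-trans (toℤ-*p b d) (*-cong b≈ d≈)) ≈-refl))) ,
    ≈-trans (toℤ-+p (a *p d) (b *p c))
      (+-cong (≈-trans (toℤ-*p a d) (*-cong a≈ d≈)) (≈-trans (toℤ-*p b c) (*-cong b≈ c≈)))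

  negF-≈₂ : ∀ {u} x → u ≈₂ x → negF u ≈₂ ⊝√ x
  negF-≈₂ {a , b} _ (a≈ , b≈) = ≈-trans (toℤ-negp a) (-‿cong a≈) , ≈-trans (toℤ-negp b) (-‿cong b≈)

  -- Terms of F_p² = F_p(√Δ) in n variables ranging over F_p; a leaf gives both coordinates
  -- as integer polynomials in Δ (variable 0) and the n variables.
  data Expr² (n : ℕ) : Set where
    ⟨_,_⟩ : Expr ℤ (suc n) → Expr ℤ (suc n) → Expr² n
    _⊞_ _⊠_ : Expr² n → Expr² n → Expr² n
    ⊟_ : Expr² n → Expr² n

  infixl 6 _⊞_
  infixl 7 _⊠_
  infix 8 ⊟_

  ⟦_⟧² : ∀ {n} → Expr² n → Vec Fp n → F2
  ⟦ ⟨ a , b ⟩ ⟧² ρ = ⟦ a ⟧ₚ (Δ ∷ ρ) , ⟦ b ⟧ₚ (Δ ∷ ρ)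
  ⟦ e ⊞ f ⟧² ρ = ⟦ e ⟧² ρ +F ⟦ f ⟧² ρ
  ⟦ e ⊠ f ⟧² ρ = ⟦ e ⟧² ρ *F ⟦ f ⟧² ρ
  ⟦ ⊟ e ⟧² ρ = negF (⟦ e ⟧² ρ)

  module _ {n : ℕ} where

    _⊕ₑ_ _⊗ₑ_ : Expr ℤ (suc n) × Expr ℤ (suc n) → Expr ℤ (suc n) × Expr ℤ (suc n) →
                Expr ℤ (suc n) × Expr ℤ (suc n)
    (e₁ , e₂) ⊕ₑ (f₁ , f₂) = e₁ ⊕ f₁ , e₂ ⊕ f₂
    (e₁ , e₂) ⊗ₑ (f₁ , f₂) = e₁ ⊗ f₁ ⊕ e₂ ⊗ f₂ ⊗ Ι Fin.zero , e₁ ⊗ f₂ ⊕ e₂ ⊗ f₁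

    ⊝ₑ_ : Expr ℤ (suc n) × Expr ℤ (suc n) → Expr ℤ (suc n) × Expr ℤ (suc n)
    ⊝ₑ (e₁ , e₂) = ⊝ e₁ , ⊝ e₂

    coordinates : Expr² n → Expr ℤ (suc n) × Expr ℤ (suc n)
    coordinates ⟨ a , b ⟩ = a , b
    coordinates (e ⊞ f) = coordinates e ⊕ₑ coordinates f
    coordinates (e ⊠ f) = coordinates e ⊗ₑ coordinates f
    coordinates (⊟ e) = ⊝ₑ coordinates e

    ⟦_⟧ℤ² : Expr ℤ (suc n) × Expr ℤ (suc n) → Vec ℤ (suc n) → ℤ × ℤ
    ⟦ e₁ , e₂ ⟧ℤ² σ = ⟦ e₁ ⟧ℤ σ , ⟦ e₂ ⟧ℤ σ

    ⟦⟧²-≈₂ : ∀ e ρ → ⟦ e ⟧² ρ ≈₂ ⟦ coordinates e ⟧ℤ² (D ∷ Vec.map toℤ ρ)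
    ⟦⟧²-≈₂ ⟨ a , b ⟩ ρ = toℤ-⟦⟧ₚ a (Δ ∷ ρ) , toℤ-⟦⟧ₚ b (Δ ∷ ρ)
    ⟦⟧²-≈₂ (e ⊞ f) ρ = +F-≈₂ _ _ (⟦⟧²-≈₂ e ρ) (⟦⟧²-≈₂ f ρ)
    ⟦⟧²-≈₂ (e ⊠ f) ρ = *F-≈₂ _ _ (⟦⟧²-≈₂ e ρ) (⟦⟧²-≈₂ f ρ)
    ⟦⟧²-≈₂ (⊟ e) ρ = negF-≈₂ _ (⟦⟧²-≈₂ e ρ)

    norm-sound² : ∀ (e f : Expr² n) →
                  ℤ-Solver.norm (proj₁ (coordinates e)) ≡ ℤ-Solver.norm (proj₁ (coordinates f)) →
                  ℤ-Solver.norm (proj₂ (coordinates e)) ≡ ℤ-Solver.norm (proj₂ (coordinates f)) →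
                  ∀ ρ → ⟦ e ⟧² ρ ≡ ⟦ f ⟧² ρ
    norm-sound² e f eq₁ eq₂ ρ with ⟦⟧²-≈₂ e ρ | ⟦⟧²-≈₂ f ρ
    ... | e₁≈ , e₂≈ | f₁≈ , f₂≈ = ≈₂-unique (e₁≈ , e₂≈)
          (subst (_ ≈_) (sym (norm-sound (proj₁ (coordinates e)) (proj₁ (coordinates f)) eq₁ σ)) f₁≈ ,
           subst (_ ≈_) (sym (norm-sound (proj₂ (coordinates e)) (proj₂ (coordinates f)) eq₂ σ)) f₂≈)
      where σ = D ∷ Vec.map toℤ ρ

  lit² : ∀ {n} → ℕ → Expr² n
  lit² k = ⟨ Κ (+ k) , Κ 0ℤ ⟩

  ⟨_,_⟩ᵥ : ∀ {n} → Fin n → Fin n → Expr² n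
  ⟨ i , j ⟩ᵥ = ⟨ Ι (Fin.suc i) , Ι (Fin.suc j) ⟩

  +F-inverseʳ : ∀ x → x +F negF x ≡ lit 0
  +F-inverseʳ (x₁ , x₂) = norm-sound² (x̂ ⊞ ⊟ x̂) (lit² 0) refl refl (x₁ ∷ x₂ ∷ [])
    where
    x̂ : Expr² 2
    x̂ = ⟨ Fin.zero , Fin.suc Fin.zero ⟩ᵥ

  module _ {n : ℕ} (ρ : Vec Fp n) where

    private
      σ = D ∷ Vec.map toℤ ρ

    ⟦⟧²≡0⇒≈0 : ∀ e (r₁ r₂ : Expr ℤ (suc n)) →
               ℤ-Solver.norm (proj₁ (coordinates e)) ≡ ℤ-Solver.norm r₁ →
               ℤ-Solver.norm (proj₂ (coordinates e)) ≡ ℤ-Solver.norm r₂ →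
               ⟦ e ⟧² ρ ≡ lit 0 → ⟦ r₁ ⟧ℤ σ ≈ 0ℤ × ⟦ r₂ ⟧ℤ σ ≈ 0ℤ
    ⟦⟧²≡0⇒≈0 e r₁ r₂ eq₁ eq₂ e≡0 with ≈₂-≡ e≡0 (⟦⟧²-≈₂ e ρ) ≈₂-lit0
    ... | e₁≈0 , e₂≈0 = subst (_≈ 0ℤ) (norm-sound (proj₁ (coordinates e)) r₁ eq₁ σ) e₁≈0 ,
                        subst (_≈ 0ℤ) (norm-sound (proj₂ (coordinates e)) r₂ eq₂ σ) e₂≈0

    ⟦⟧²-≡⇒≈0 : ∀ e f (r₁ r₂ : Expr ℤ (suc n)) →
               ℤ-Solver.norm (proj₁ (coordinates e) ⊕ ⊝ proj₁ (coordinates f)) ≡ ℤ-Solver.norm r₁ →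
               ℤ-Solver.norm (proj₂ (coordinates e) ⊕ ⊝ proj₂ (coordinates f)) ≡ ℤ-Solver.norm r₂ →
               ⟦ e ⟧² ρ ≡ ⟦ f ⟧² ρ → ⟦ r₁ ⟧ℤ σ ≈ 0ℤ × ⟦ r₂ ⟧ℤ σ ≈ 0ℤ
    ⟦⟧²-≡⇒≈0 e f r₁ r₂ eq₁ eq₂ e≡f =
      ⟦⟧²≡0⇒≈0 (e ⊞ ⊟ f) r₁ r₂ eq₁ eq₂ (trans (cong (_+F negF (⟦ f ⟧² ρ)) e≡f) (+F-inverseʳ (⟦ f ⟧² ρ)))

module QuadraticField (p : ℕ) {{_ : NonZero p}} (Δ : Fin p) (p-prime : Prime p) (Δ-nonsquare : Field.NonsquareFp p Δ) where

  open import Algebra.Bundles using (CommutativeMonoid)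
  open import Data.Fin using (#_)
  open import Data.Integer using (ℤ; +_; 0ℤ; 1ℤ; _+_; _*_; -_; _-_)
  open import Data.Integer.Tactic.RingSolver using (solve-∀)
  open import Data.Nat as ℕ using (ℕ)
  open import Data.Product using (_×_; _,_; proj₁; proj₂)
  open import Data.Vec using (_∷_; [])
  open import Relation.Binary.PropositionalEquality using (_≡_; _≢_; refl; sym; trans; cong₂; isEquivalence)
  open import Relation.Nullary using (yes; no)

  open Field p Δ
  open Congruence p
  open Lifting p Δ
  open IntegralDomain p-prime

  D-nonsquare : ∀ z → z * z - D ≉ 0ℤ
  D-nonsquare z z²-D≈0 = Δ-nonsquare (fromℤ z , toℤ-injective z²≈D)
    where
    z²≈D : toℤ (fromℤ z *p fromℤ z) ≈ D
    z²≈D = ≈-trans (toℤ-*p (fromℤ z) (fromℤ z)) (≈-trans (*-cong (toℤ-fromℤ z) (toℤ-fromℤ z)) (-≈0⇒≈ z²-D≈0))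

  D≉0 : D ≉ 0ℤ
  D≉0 D≈0 = D-nonsquare 0ℤ (≈⇒-≈0 (≈-sym D≈0))

  norm : ℤ × ℤ → ℤ
  norm (a , b) = a * a - D * (b * b)

  norm≉0 : ∀ {x} → x ≢ lit 0 → norm (toℤ₂ x) ≉ 0ℤ
  norm≉0 {a , b} x≢0 N≈0 with ≈? (toℤ b) 0ℤ
  ... | yes b≈0 = x≢0 (≈₂-unique (a²≈0⇒a≈0 a²≈0 , b≈0) ≈₂-lit0)
    where
    a²≈0 : toℤ a * toℤ a ≈ 0ℤ
    a²≈0 = ≈0-by (square-from-norm (toℤ a) (toℤ b) D) (combination≈0 1ℤ (D * toℤ b) N≈0 b≈0)
      where
      square-from-norm : ∀ a b D → a * a ≡ 1ℤ * (a * a - D * (b * b)) + (D * b) * b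
      square-from-norm = solve-∀
  ... | no b≉0 with toℤ-invertible b b≉0
  ...   | z , bz≈1 = D-nonsquare (toℤ a * z) (≈0-by (rescaled (toℤ a) (toℤ b) z D)
                       (combination≈0 (z * z) (D * (toℤ b * z + 1ℤ)) N≈0 (≈⇒-≈0 bz≈1)))
    where
    rescaled : ∀ a b z D → (a * z) * (a * z) - D ≡ (z * z) * (a * a - D * (b * b)) + (D * (b * z + 1ℤ)) * (b * z - 1ℤ)
    rescaled = solve-∀

  -- Multiplying x (y - z) by the conjugate of x gives norm x · (y - z).
  *F-cancelˡ : ∀ x {y z} → x ≢ lit 0 → x *F y ≡ x *F z → y ≡ z
  *F-cancelˡ x@(x₁ , x₂) {y@(y₁ , y₂)} {z@(z₁ , z₂)} x≢0 xy≡xz = ≈₂-unique (≈₂-toℤ₂ y) (≈-sym first , ≈-sym second)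
    where
    X₁ = toℤ x₁
    X₂ = toℤ x₂
    equal : (proj₁ (toℤ₂ x ⊗√ toℤ₂ y) ≈ proj₁ (toℤ₂ x ⊗√ toℤ₂ z)) ×
            (proj₂ (toℤ₂ x ⊗√ toℤ₂ y) ≈ proj₂ (toℤ₂ x ⊗√ toℤ₂ z))
    equal = ≈₂-≡ xy≡xz (*F-≈₂ _ _ (≈₂-toℤ₂ x) (≈₂-toℤ₂ y)) (*F-≈₂ _ _ (≈₂-toℤ₂ x) (≈₂-toℤ₂ z))
    first-coordinate : ∀ x₁ x₂ y₁ y₂ z₁ z₂ D →
      (x₁ * x₁ - D * (x₂ * x₂)) * (y₁ - z₁) ≡
      x₁ * ((x₁ * y₁ + x₂ * y₂ * D) - (x₁ * z₁ + x₂ * z₂ * D)) + (- (D * x₂)) * ((x₁ * y₂ + x₂ * y₁) - (x₁ * z₂ + x₂ * z₁))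
    first-coordinate = solve-∀
    second-coordinate : ∀ x₁ x₂ y₁ y₂ z₁ z₂ D →
      (x₁ * x₁ - D * (x₂ * x₂)) * (y₂ - z₂) ≡
      x₁ * ((x₁ * y₂ + x₂ * y₁) - (x₁ * z₂ + x₂ * z₁)) + (- x₂) * ((x₁ * y₁ + x₂ * y₂ * D) - (x₁ * z₁ + x₂ * z₂ * D))
    second-coordinate = solve-∀
    first : toℤ y₁ ≈ toℤ z₁
    first = -≈0⇒≈ (*-cancelˡ-≈0 (norm≉0 x≢0) (≈0-by (first-coordinate X₁ X₂ (toℤ y₁) (toℤ y₂) (toℤ z₁) (toℤ z₂) D)
              (combination≈0 X₁ (- (D * X₂)) (≈⇒-≈0 (proj₁ equal)) (≈⇒-≈0 (proj₂ equal)))))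
    second : toℤ y₂ ≈ toℤ z₂
    second = -≈0⇒≈ (*-cancelˡ-≈0 (norm≉0 x≢0) (≈0-by (second-coordinate X₁ X₂ (toℤ y₁) (toℤ y₂) (toℤ z₁) (toℤ z₂) D)
              (combination≈0 X₁ (- X₂) (≈⇒-≈0 (proj₂ equal)) (≈⇒-≈0 (proj₁ equal)))))

  private
    x̂ : ∀ {n} → Expr² (2 ℕ.+ n)
    x̂ = ⟨ # 0 , # 1 ⟩ᵥ
    ŷ : ∀ {n} → Expr² (4 ℕ.+ n)
    ŷ = ⟨ # 2 , # 3 ⟩ᵥ
    ẑ : ∀ {n} → Expr² (6 ℕ.+ n)
    ẑ = ⟨ # 4 , # 5 ⟩ᵥ

  *F-comm : ∀ x y → x *F y ≡ y *F x
  *F-comm (x₁ , x₂) (y₁ , y₂) = norm-sound² (x̂ ⊠ ŷ) (ŷ ⊠ x̂) refl refl (x₁ ∷ x₂ ∷ y₁ ∷ y₂ ∷ [])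

  *F-assoc : ∀ x y z → (x *F y) *F z ≡ x *F (y *F z)
  *F-assoc (x₁ , x₂) (y₁ , y₂) (z₁ , z₂) =
    norm-sound² ((x̂ ⊠ ŷ) ⊠ ẑ) (x̂ ⊠ (ŷ ⊠ ẑ)) refl refl (x₁ ∷ x₂ ∷ y₁ ∷ y₂ ∷ z₁ ∷ z₂ ∷ [])

  *F-identityˡ : ∀ x → lit 1 *F x ≡ x
  *F-identityˡ (x₁ , x₂) = norm-sound² (lit² 1 ⊠ x̂) x̂ refl refl (x₁ ∷ x₂ ∷ [])

  *F-zeroʳ : ∀ x → x *F lit 0 ≡ lit 0
  *F-zeroʳ (x₁ , x₂) = norm-sound² (x̂ ⊠ lit² 0) (lit² 0) refl refl (x₁ ∷ x₂ ∷ [])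

  *F-distribˡ : ∀ x y z → x *F (y +F z) ≡ (x *F y) +F (x *F z)
  *F-distribˡ (x₁ , x₂) (y₁ , y₂) (z₁ , z₂) =
    norm-sound² (x̂ ⊠ (ŷ ⊞ ẑ)) (x̂ ⊠ ŷ ⊞ x̂ ⊠ ẑ) refl refl (x₁ ∷ x₂ ∷ y₁ ∷ y₂ ∷ z₁ ∷ z₂ ∷ [])

  *F-commutativeMonoid : CommutativeMonoid _ _
  *F-commutativeMonoid = record
    { Carrier = F2 ; _≈_ = _≡_ ; _∙_ = _*F_ ; ε = lit 1
    ; isCommutativeMonoid = record
      { isMonoid = record
        { isSemigroup = record
          { isMagma = record { isEquivalence = isEquivalence ; ∙-cong = cong₂ _*F_ }
          ; assoc = *F-assoc }
        ; identity = *F-identityˡ , λ x → trans (*F-comm x (lit 1)) (*F-identityˡ x) }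
      ; comm = *F-comm } }

  *F-≢0 : ∀ {x y} → x ≢ lit 0 → y ≢ lit 0 → x *F y ≢ lit 0
  *F-≢0 {x} {y} x≢0 y≢0 xy≡0 = y≢0 (*F-cancelˡ x x≢0 (trans xy≡0 (sym (*F-zeroʳ x))))

  nonsquare⇒≢0 : ∀ {d} → NonsquareF2 d → d ≢ lit 0
  nonsquare⇒≢0 d-nonsquare refl = d-nonsquare (lit 0 , *F-zeroʳ (lit 0))

module Curves (p : ℕ) {{_ : NonZero p}} (Δ : Fin p) (p-prime : Prime p) (Δ-nonsquare : Field.NonsquareFp p Δ) where

  import Algebra.Solver.CommutativeMonoid as CommutativeMonoidSolver
  open import Data.Product using (Σ; _,_; proj₁; proj₂)
  open import Relation.Binary.PropositionalEquality using (_≡_; _≢_; refl; sym; trans; cong; cong₂; module ≡-Reasoning)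

  open Field p Δ
  open QuadraticField p Δ p-prime Δ-nonsquare
  open CommutativeMonoidSolver *F-commutativeMonoid using (Expr; solve; _⊜_) renaming (_⊕_ to _·_)

  private
    sqₑ cubeₑ : ∀ {n} → Expr n → Expr n
    sqₑ x = x · x
    cubeₑ x = x · sqₑ x

  *F-cancelʳ : ∀ {x y} z → z ≢ lit 0 → x *F z ≡ y *F z → x ≡ y
  *F-cancelʳ {x} {y} z z≢0 xz≡yz = *F-cancelˡ z z≢0 (trans (*F-comm z x) (trans xz≡yz (*F-comm y z)))

  -- For nonsingular curves this is equality of j-invariants, j(a , b) = 1728 · 4a³ / (4a³ + 27b²).
  SameJ : Curve → Curve → Set
  SameJ (a , b) (a' , b') = cube a' *F sq b ≡ cube a *F sq b'

  isomorphic⇒SameJ : ∀ E E' → Isomorphic E E' → SameJ E E'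
  isomorphic⇒SameJ (a , b) _ (u , _ , refl , refl) =
    solve 3 (λ u a b → cubeₑ (sqₑ (sqₑ u) · a) · sqₑ b ⊜ cubeₑ a · sqₑ (cubeₑ (sqₑ u) · b)) refl u a b

  SameJ-twist⁻¹ : ∀ {d} E E' → d ≢ lit 0 → SameJ (twist d E) (twist d E') → SameJ E E'
  SameJ-twist⁻¹ {d} (a , b) (a' , b') d≢0 same = *F-cancelˡ d¹² d¹²≢0 (begin
    d¹² *F (cube a' *F sq b)               ≡⟨ scale d a' b ⟨
    cube (sq d *F a') *F sq (cube d *F b)  ≡⟨ same ⟩
    cube (sq d *F a) *F sq (cube d *F b')  ≡⟨ scale d a b' ⟩
    d¹² *F (cube a *F sq b')               ∎)
    where
    open ≡-Reasoning
    d¹² = cube (sq d) *F sq (cube d)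
    d¹²≢0 : d¹² ≢ lit 0
    d¹²≢0 = *F-≢0 (*F-≢0 d²≢0 (*F-≢0 d²≢0 d²≢0)) (*F-≢0 d³≢0 d³≢0)
      where
      d²≢0 = *F-≢0 d≢0 d≢0
      d³≢0 = *F-≢0 d≢0 d²≢0
    scale : ∀ d a b → cube (sq d *F a) *F sq (cube d *F b) ≡ (cube (sq d) *F sq (cube d)) *F (cube a *F sq b)
    scale = solve 3 (λ d a b → cubeₑ (sqₑ d · a) · sqₑ (cubeₑ d · b) ⊜ (cubeₑ (sqₑ d) · sqₑ (cubeₑ d)) · (cubeₑ a · sqₑ b))
                  refl

  private
    d⁶≢0 : ∀ {d} → d ≢ lit 0 → cube (sq d) ≢ lit 0
    d⁶≢0 d≢0 = *F-≢0 d²≢0 (*F-≢0 d²≢0 d²≢0)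
      where d²≢0 = *F-≢0 d≢0 d≢0

  SameJ-twistʳ⁻¹ : ∀ {d} E E' → d ≢ lit 0 → SameJ E (twist d E') → SameJ E E'
  SameJ-twistʳ⁻¹ {d} (a , b) (a' , b') d≢0 same = *F-cancelˡ (cube (sq d)) (d⁶≢0 d≢0) (begin
    cube (sq d) *F (cube a' *F sq b)   ≡⟨ scaleˡ d a' b ⟨
    cube (sq d *F a') *F sq b          ≡⟨ same ⟩
    cube a *F sq (cube d *F b')        ≡⟨ scaleʳ d a b' ⟩
    cube (sq d) *F (cube a *F sq b')   ∎)
    where
    open ≡-Reasoning
    scaleˡ : ∀ d a b → cube (sq d *F a) *F sq b ≡ cube (sq d) *F (cube a *F sq b)
    scaleˡ = solve 3 (λ d a b → cubeₑ (sqₑ d · a) · sqₑ b ⊜ cubeₑ (sqₑ d) · (cubeₑ a · sqₑ b)) refl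
    scaleʳ : ∀ d a b → cube a *F sq (cube d *F b) ≡ cube (sq d) *F (cube a *F sq b)
    scaleʳ = solve 3 (λ d a b → cubeₑ a · sqₑ (cubeₑ d · b) ⊜ cubeₑ (sqₑ d) · (cubeₑ a · sqₑ b)) refl

  twist-nonsingular : ∀ {d} E → d ≢ lit 0 → Nonsingular E → Nonsingular (twist d E)
  twist-nonsingular {d} (a , b) d≢0 nonsingular disc≡0 =
    nonsingular (*F-cancelˡ (cube (sq d)) (d⁶≢0 d≢0)
      (trans (sym discriminant-scales) (trans disc≡0 (sym (*F-zeroʳ (cube (sq d)))))))
    where
    open ≡-Reasoning
    discriminant-scales : (lit 4 *F cube (sq d *F a)) +F (lit 27 *F sq (cube d *F b)) ≡
                          cube (sq d) *F ((lit 4 *F cube a) +F (lit 27 *F sq b))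
    discriminant-scales = begin
      (lit 4 *F cube (sq d *F a)) +F (lit 27 *F sq (cube d *F b))
        ≡⟨ cong₂ _+F_ (solve 3 (λ d c a → c · cubeₑ (sqₑ d · a) ⊜ cubeₑ (sqₑ d) · (c · cubeₑ a)) refl d (lit 4) a)
                       (solve 3 (λ d c b → c · sqₑ (cubeₑ d · b) ⊜ cubeₑ (sqₑ d) · (c · sqₑ b)) refl d (lit 27) b) ⟩
      (cube (sq d) *F (lit 4 *F cube a)) +F (cube (sq d) *F (lit 27 *F sq b))
        ≡⟨ *F-distribˡ (cube (sq d)) _ _ ⟨
      cube (sq d) *F ((lit 4 *F cube a) +F (lit 27 *F sq b)) ∎

  isomorphic-to-twist⇒square : ∀ {d} E → proj₁ E ≢ lit 0 → proj₂ E ≢ lit 0 →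
                               Isomorphic E (twist d E) → Σ F2 λ u → u *F u ≡ d
  isomorphic-to-twist⇒square {d} (a , b) a≢0 b≢0 (u , u≢0 , d²a≡u⁴a , d³b≡u⁶b) = u , sym d≡u²
    where
    u²≢0 = *F-≢0 u≢0 u≢0
    d²≡u⁴ : sq d ≡ sq (sq u)
    d²≡u⁴ = *F-cancelʳ a a≢0 d²a≡u⁴a
    d³≡u⁶ : cube d ≡ cube (sq u)
    d³≡u⁶ = *F-cancelʳ b b≢0 d³b≡u⁶b
    d≡u² : d ≡ sq u
    d≡u² = *F-cancelʳ (sq (sq u)) (*F-≢0 u²≢0 u²≢0) (begin
      d *F sq (sq u)      ≡⟨ cong (d *F_) d²≡u⁴ ⟨
      cube d              ≡⟨ d³≡u⁶ ⟩
      cube (sq u)         ≡⟨ *F-comm (sq u) (sq (sq u)) ⟩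
      sq (sq u) *F sq u   ≡⟨ *F-comm (sq (sq u)) (sq u) ⟩
      sq u *F sq (sq u)   ∎)
      where open ≡-Reasoning

module Family (p : ℕ) {{_ : NonZero p}} (Δ : Fin p) (p-prime : Prime p) (p≥11 : 11 ≤ p)
    (Δ-nonsquare : Field.NonsquareFp p Δ) where

  open import Data.Fin using (Fin; #_)
  open import Data.Integer using (ℤ; +_; 0ℤ; 1ℤ; _+_; _*_; -_; _-_)
  open import Data.Integer.Tactic.RingSolver using (solve-∀)
  open import Data.Nat as ℕ using (ℕ; suc; NonZero)
  import Data.Nat.Properties as ℕ
  open import Data.Product using (_×_; _,_; proj₁; proj₂)
  open import Data.Sum using ([_,_]′)
  open import Data.Vec using (_∷_; [])
  open import Function using (id)
  open import Relation.Binary.PropositionalEquality using (_≡_; _≢_; refl)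
  open import Relation.Nullary.Decidable using (True; toWitness)
  open import Tactic.RingSolver.Core.Expression using (Expr; Κ; Ι; _⊕_; _⊗_; ⊝_)

  open Field p Δ
  open Congruence p
  open IntegralDomain p-prime
  open Lifting p Δ
  open QuadraticField p Δ p-prime Δ-nonsquare
  open Curves p Δ p-prime Δ-nonsquare

  <11⇒≉0 : ∀ k .{{_ : NonZero k}} {k<11 : True (k ℕ.<? 11)} → + k ≉ 0ℤ
  <11⇒≉0 k@(suc _) {k<11} = small≉0 k (ℕ.s≤s ℕ.z≤n) (ℕ.<-≤-trans (toWitness k<11) p≥11)

  2≉0 : + 2 ≉ 0ℤ
  2≉0 = <11⇒≉0 2
  3≉0 : + 3 ≉ 0ℤ
  3≉0 = <11⇒≉0 3
  5≉0 : + 5 ≉ 0ℤ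
  5≉0 = <11⇒≉0 5
  7≉0 : + 7 ≉ 0ℤ
  7≉0 = <11⇒≉0 7

  432≉0 : + 432 ≉ 0ℤ
  432≉0 = 2≉0 *≉0 2≉0 *≉0 2≉0 *≉0 2≉0 *≉0 3≉0 *≉0 3≉0 *≉0 3≉0

  module _ {n : ℕ} where

    Ĉ Â B̂ : Fin n → Expr² n
    Ĉ v = ⟨ Κ (+ 2) , Κ (+ 2) ⊗ Ι (Fin.suc v) ⟩
    Â v = ⊟ (lit² 3 ⊠ (lit² 2 ⊠ Ĉ v ⊞ lit² 1))
    B̂ v = Ĉ v ⊠ Ĉ v ⊞ lit² 10 ⊠ Ĉ v ⊞ ⊟ lit² 2

  private
    D̂ ŝ : ∀ {n} → Expr ℤ (2 ℕ.+ n)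
    t̂ : ∀ {n} → Expr ℤ (3 ℕ.+ n)
    D̂ = Ι (# 0)
    ŝ = Ι (# 1)
    t̂ = Ι (# 2)

  A≢0 : ∀ s → proj₁ (E3 s) ≢ lit 0
  A≢0 s A≡0 = -‿≉0 (3≉0 *≉0 5≉0) (proj₁ coordinates≈0)
    where
    coordinates≈0 : - + 15 ≈ 0ℤ × - (+ 12 * toℤ s) ≈ 0ℤ
    coordinates≈0 = ⟦⟧²≡0⇒≈0 (s ∷ []) (Â (# 0)) (Κ (- + 15)) (⊝ (Κ (+ 12) ⊗ ŝ)) refl refl A≡0

  B≡0⇒s≈0∧11≈0 : ∀ s → proj₂ (E3 s) ≡ lit 0 → toℤ s ≈ 0ℤ × + 11 ≈ 0ℤ
  B≡0⇒s≈0∧11≈0 s B≡0 = s≈0 , *-cancelˡ-≈0 2≉0 22≈0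
    where
    coordinates≈0 : + 22 + + 4 * toℤ s * toℤ s * D ≈ 0ℤ × + 28 * toℤ s ≈ 0ℤ
    coordinates≈0 = ⟦⟧²≡0⇒≈0 (s ∷ []) (B̂ (# 0)) (Κ (+ 22) ⊕ Κ (+ 4) ⊗ ŝ ⊗ ŝ ⊗ D̂) (Κ (+ 28) ⊗ ŝ) refl refl B≡0
    s≈0 : toℤ s ≈ 0ℤ
    s≈0 = *-cancelˡ-≈0 (2≉0 *≉0 2≉0 *≉0 7≉0) (proj₂ coordinates≈0)
    22≈0 : + 22 ≈ 0ℤ
    22≈0 = ≈0-by (constant-term (toℤ s) D) (combination≈0 1ℤ (- (+ 4 * toℤ s * D)) (proj₁ coordinates≈0) s≈0)
      where
      constant-term : ∀ s D → + 22 ≡ 1ℤ * (+ 22 + + 4 * s * s * D) + (- (+ 4 * s * D)) * s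
      constant-term = solve-∀

  E3-nonsingular : ∀ s → Nonsingular (E3 s)
  E3-nonsingular s disc≡0 =
    [ s≉0 , 1-s²D≉0 ]′ (*≈0⇒≈0⊎≈0 S (1ℤ - S * S * D) (*-cancelˡ-≈0 (432≉0 *≉0 2≉0) (proj₂ coordinates≈0)))
    where
    S = toℤ s
    coordinates≈0 : + 432 * (S * S * S * S * D * D - 1ℤ) ≈ 0ℤ × + 864 * (S * (1ℤ - S * S * D)) ≈ 0ℤ
    coordinates≈0 = ⟦⟧²≡0⇒≈0 (s ∷ []) (lit² 4 ⊠ (Â (# 0) ⊠ (Â (# 0) ⊠ Â (# 0))) ⊞ lit² 27 ⊠ (B̂ (# 0) ⊠ B̂ (# 0)))
      (Κ (+ 432) ⊗ (ŝ ⊗ ŝ ⊗ ŝ ⊗ ŝ ⊗ D̂ ⊗ D̂ ⊕ ⊝ Κ 1ℤ)) (Κ (+ 864) ⊗ (ŝ ⊗ (Κ 1ℤ ⊕ ⊝ (ŝ ⊗ ŝ ⊗ D̂)))) refl refl disc≡0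
    s⁴D²-1≈0 : S * S * S * S * D * D - 1ℤ ≈ 0ℤ
    s⁴D²-1≈0 = *-cancelˡ-≈0 432≉0 (proj₁ coordinates≈0)
    s≉0 : S ≉ 0ℤ
    s≉0 s≈0 = -‿≉0 (<11⇒≉0 1) (≈0-by (minus-one S D) (combination≈0 1ℤ (- (S * S * S * D * D)) s⁴D²-1≈0 s≈0))
      where
      minus-one : ∀ s D → - 1ℤ ≡ 1ℤ * (s * s * s * s * D * D - 1ℤ) + (- (s * s * s * D * D)) * s
      minus-one = solve-∀
    1-s²D≉0 : 1ℤ - S * S * D ≉ 0ℤ
    1-s²D≉0 1-s²D≈0 = D-nonsquare (S * D) (≈0-by (square-defect S D) (*-zeroʳ-≈ (- D) 1-s²D≈0))
      where
      square-defect : ∀ s D → (s * D) * (s * D) - D ≡ (- D) * (1ℤ - s * s * D)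
      square-defect = solve-∀

  -- Stated over an arbitrary signature so that the integer polynomials and the expressions
  -- handed to the normaliser below agree definitionally.
  module Polynomials {A : Set} (_⊞_ _⊠_ : A → A → A) (con : ℤ → A) where

    κ ε : A → A → A
    κ S P = ((con (- + 240) ⊞ (con (- + 125) ⊠ S)) ⊞ (con (+ 978) ⊠ P)) ⊞ ((con (- + 240) ⊠ P) ⊠ P)
    ε S P = ((((con (- + 550) ⊞ (con (+ 186) ⊠ S)) ⊞ ((con (- + 300) ⊠ P) ⊠ S)) ⊞ (con (+ 294) ⊠ P))
              ⊞ ((con (+ 780) ⊠ P) ⊠ P)) ⊞ (((con (- + 64) ⊠ P) ⊠ P) ⊠ P)

  open Polynomials _+_ _*_ id public using (κ; ε)
  module Syntax {n} = Polynomials {Expr ℤ n} _⊕_ _⊗_ Κ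

  σ π : Fp → Fp → ℤ
  σ s t = toℤ s + toℤ t
  π s t = toℤ s * toℤ t * D

  -- With σ = s + t and π = stΔ, the coordinates of a_t³ b_s² − a_s³ b_t² are 432 (s − t) (Δ σ κ, ε).
  Bad : Fp → Fp → Set
  Bad s t = (σ s t * κ (σ s t * σ s t * D) (π s t) ≈ 0ℤ) × (ε (σ s t * σ s t * D) (π s t) ≈ 0ℤ)

  SameJ-E3⇒Bad : ∀ {s t} → s ≢ t → SameJ (E3 s) (E3 t) → Bad s t
  SameJ-E3⇒Bad {s} {t} s≢t same =
    *-cancelˡ-≈0 (432≉0 *≉0 s-t≉0 *≉0 D≉0) (proj₁ coordinates≈0) ,
    *-cancelˡ-≈0 (432≉0 *≉0 s-t≉0) (proj₂ coordinates≈0)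
    where
    s-t≉0 : toℤ s - toℤ t ≉ 0ℤ
    s-t≉0 s-t≈0 = s≢t (toℤ-injective (-≈0⇒≈ s-t≈0))
    σ̂ π̂ : Expr ℤ 3
    σ̂ = ŝ ⊕ t̂
    π̂ = ŝ ⊗ t̂ ⊗ D̂
    Ĵ : Fin 2 → Fin 2 → Expr² 2
    Ĵ v w = Â w ⊠ (Â w ⊠ Â w) ⊠ (B̂ v ⊠ B̂ v)
    coordinates≈0 : + 432 * (toℤ s - toℤ t) * D * (σ s t * κ (σ s t * σ s t * D) (π s t)) ≈ 0ℤ ×
                    + 432 * (toℤ s - toℤ t) * ε (σ s t * σ s t * D) (π s t) ≈ 0ℤ
    coordinates≈0 = ⟦⟧²-≡⇒≈0 (s ∷ t ∷ []) (Ĵ (# 0) (# 1)) (Ĵ (# 1) (# 0))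
      (Κ (+ 432) ⊗ (ŝ ⊕ ⊝ t̂) ⊗ D̂ ⊗ (σ̂ ⊗ Syntax.κ (σ̂ ⊗ σ̂ ⊗ D̂) π̂))
      (Κ (+ 432) ⊗ (ŝ ⊕ ⊝ t̂) ⊗ Syntax.ε (σ̂ ⊗ σ̂ ⊗ D̂) π̂) refl refl same

module Classification (p : ℕ) {{_ : NonZero p}} (Δ : Fin p) (p-prime : Prime p) (p≥11 : 11 ≤ p)
    (Δ-nonsquare : Field.NonsquareFp p Δ) where

  open import Data.Bool using (Bool; T)
  open import Data.Empty using (⊥; ⊥-elim)
  open import Data.Fin using (Fin; zero; suc; toℕ; #_)
  import Data.Fin.Properties as Fin
  open import Data.Integer using (ℤ; +_; 0ℤ; 1ℤ; _+_; _*_; -_; _-_)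
  import Data.Integer.Properties as ℤ
  open import Data.Integer.Tactic.RingSolver using (solve-∀; ring)
  open import Data.Nat as ℕ using (ℕ)
  import Data.Nat.Properties as ℕ
  open import Data.Product using (Σ; _×_; _,_; proj₁; proj₂; uncurry)
  open import Data.Product.Properties using (,-injective)
  open import Data.Sum as Sum using (_⊎_; inj₁; inj₂; [_,_]′)
  open import Data.Sum.Properties using (inj₂-injective)
  open import Function using (_∘_; id)
  open import Relation.Binary.PropositionalEquality using (_≡_; refl; sym; trans; cong; subst; subst₂)
  open import Tactic.RingSolver.Core.Expression using (Κ; _⊕_; _⊗_; ⊝_)
  import Tactic.RingSolver.NonReflective as NonReflective

  open Field p Δ
  open Congruence p
  open IntegralDomain p-prime
  open Lifting p Δ using (D; solve; toℤ-+p; toℤ-negp)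
  open QuadraticField p Δ p-prime Δ-nonsquare using (D≉0; D-nonsquare)
  open Family p Δ p-prime p≥11 Δ-nonsquare
  open NonReflective ring using (_⊜_)

  Root : ℤ × ℤ → ℤ → Set
  Root (c , e) P = c * P - e ≈ 0ℤ

  σ-roots : Fin 2 → ℤ × ℤ
  σ-roots zero = + 16 , + 11
  σ-roots (suc _) = + 2 , + 25

  κ-roots : Fin 3 → ℤ × ℤ
  κ-roots zero = + 25 , + 29
  κ-roots (suc zero) = + 128 , + 115
  κ-roots (suc (suc _)) = + 10 , + 17

  σ-case : ∀ {s t} → σ s t ≈ 0ℤ → ε (σ s t * σ s t * D) (π s t) ≈ 0ℤ →
           Σ (Fin 2) λ k → Root (σ-roots k) (π s t)
  σ-case {s} {t} σ≈0 ε≈0 =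
    [ two-roots , ⊥-elim ∘ π+1≉0 ]′ (*≈0⇒≈0⊎≈0 ((+ 16 * π s t - + 11) * (+ 2 * π s t - + 25)) (π s t + 1ℤ) product≈0)
    where
    eliminate-σ : ∀ σ D P → - + 2 * ((+ 16 * P - + 11) * (+ 2 * P - + 25) * (P + 1ℤ)) ≡
                            1ℤ * ε (σ * σ * D) P + (- (σ * D * (+ 186 - + 300 * P))) * σ
    eliminate-σ = solve 3 (λ σ D P → Κ (- + 2) ⊗ ((Κ (+ 16) ⊗ P ⊕ ⊝ Κ (+ 11)) ⊗ (Κ (+ 2) ⊗ P ⊕ ⊝ Κ (+ 25)) ⊗ (P ⊕ Κ 1ℤ)) ⊜
                                      (Κ 1ℤ ⊗ Syntax.ε (σ ⊗ σ ⊗ D) P ⊕ ⊝ (σ ⊗ D ⊗ (Κ (+ 186) ⊕ ⊝ (Κ (+ 300) ⊗ P))) ⊗ σ)) refl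
    product≈0 : (+ 16 * π s t - + 11) * (+ 2 * π s t - + 25) * (π s t + 1ℤ) ≈ 0ℤ
    product≈0 = *-cancelˡ-≈0 (-‿≉0 2≉0) (≈0-by (eliminate-σ (σ s t) D (π s t))
                  (combination≈0 1ℤ (- (σ s t * D * (+ 186 - + 300 * π s t))) ε≈0 σ≈0))
    two-roots : (+ 16 * π s t - + 11) * (+ 2 * π s t - + 25) ≈ 0ℤ → Σ (Fin 2) λ k → Root (σ-roots k) (π s t)
    two-roots r₀r₁ = [ (λ r₀ → # 0 , r₀) , (λ r₁ → # 1 , r₁) ]′ (*≈0⇒≈0⊎≈0 (+ 16 * π s t - + 11) (+ 2 * π s t - + 25) r₀r₁)
    -- with t ≈ -s, π + 1 ≈ 0 says s²Δ = 1, i.e. Δ = (sΔ)²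
    π+1≉0 : π s t + 1ℤ ≉ 0ℤ
    π+1≉0 π+1≈0 = D-nonsquare (toℤ s * D)
      (≈0-by (square-defect (toℤ s) (toℤ t) D) (combination≈0 (- D) (toℤ s * D * D) π+1≈0 σ≈0))
      where
      square-defect : ∀ s t D → (s * D) * (s * D) - D ≡ (- D) * (s * t * D + 1ℤ) + (s * D * D) * (s + t)
      square-defect = solve-∀

  κ-case : ∀ {S P} → κ S P ≈ 0ℤ → ε S P ≈ 0ℤ → Σ (Fin 3) λ k → Root (κ-roots k) P
  κ-case {S} {P} κ≈0 ε≈0 =
    [ two-roots , (λ r₂ → # 2 , r₂) ]′ (*≈0⇒≈0⊎≈0 ((+ 25 * P - + 29) * (+ 128 * P - + 115)) (+ 10 * P - + 17) product≈0)
    where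
    eliminate-S : ∀ S P → + 125 * ε S P + (+ 186 - + 300 * P) * κ S P ≡
                          + 2 * ((+ 25 * P - + 29) * (+ 128 * P - + 115) * (+ 10 * P - + 17))
    eliminate-S = solve 2 (λ S P → Κ (+ 125) ⊗ Syntax.ε S P ⊕ (Κ (+ 186) ⊕ ⊝ (Κ (+ 300) ⊗ P)) ⊗ Syntax.κ S P ⊜
                                   Κ (+ 2) ⊗ ((Κ (+ 25) ⊗ P ⊕ ⊝ Κ (+ 29)) ⊗ (Κ (+ 128) ⊗ P ⊕ ⊝ Κ (+ 115)) ⊗ (Κ (+ 10) ⊗ P ⊕ ⊝ Κ (+ 17)))) refl
    product≈0 : (+ 25 * P - + 29) * (+ 128 * P - + 115) * (+ 10 * P - + 17) ≈ 0ℤ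
    product≈0 = *-cancelˡ-≈0 2≉0 (≈0-by (sym (eliminate-S S P)) (combination≈0 (+ 125) (+ 186 - + 300 * P) ε≈0 κ≈0))
    two-roots : (+ 25 * P - + 29) * (+ 128 * P - + 115) ≈ 0ℤ → Σ (Fin 3) λ k → Root (κ-roots k) P
    two-roots r₀r₁ = [ (λ r₀ → # 0 , r₀) , (λ r₁ → # 1 , r₁) ]′ (*≈0⇒≈0⊎≈0 (+ 25 * P - + 29) (+ 128 * P - + 115) r₀r₁)

  σ-roots-≉0 : ∀ k → proj₁ (σ-roots k) ≉ 0ℤ
  σ-roots-≉0 zero = 2≉0 *≉0 2≉0 *≉0 2≉0 *≉0 2≉0
  σ-roots-≉0 (suc _) = 2≉0

  κ-roots-≉0 : ∀ k → proj₁ (κ-roots k) ≉ 0ℤ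
  κ-roots-≉0 zero = 5≉0 *≉0 5≉0
  κ-roots-≉0 (suc zero) = 2≉0 *≉0 2≉0 *≉0 2≉0 *≉0 2≉0 *≉0 2≉0 *≉0 2≉0 *≉0 2≉0
  κ-roots-≉0 (suc (suc _)) = 2≉0 *≉0 5≉0

  root-unique : ∀ r {P P'} → proj₁ r ≉ 0ℤ → Root r P → Root r P' → P ≈ P'
  root-unique (c , e) {P} {P'} c≉0 rP rP' =
    -≈0⇒≈ (*-cancelˡ-≈0 c≉0 (≈0-by (difference c e P P') (combination≈0 1ℤ (- 1ℤ) rP rP')))
    where
    difference : ∀ c e P P' → c * (P - P') ≡ 1ℤ * (c * P - e) + (- 1ℤ) * (c * P' - e)
    difference = solve-∀

  π-injective : ∀ {s t s' t'} → π s t ≈ π s' t' → toℤ s * toℤ t ≈ toℤ s' * toℤ t'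
  π-injective {s} {t} {s'} {t'} π≈π' =
    -≈0⇒≈ (*-cancelˡ-≈0 D≉0 (≈0-by (factor-D (toℤ s) (toℤ t) (toℤ s') (toℤ t') D) (≈⇒-≈0 π≈π')))
    where
    factor-D : ∀ s t s' t' D → D * (s * t - s' * t') ≡ s * t * D - s' * t' * D
    factor-D = solve-∀

  same-pair : ∀ {s t s' t'} → toℕ t ℕ.< toℕ s → toℕ t' ℕ.< toℕ s' →
              σ s t ≈ σ s' t' → toℤ s * toℤ t ≈ toℤ s' * toℤ t' → s ≡ s'
  same-pair {s} {t} {s'} {t'} t<s t'<s' σ≈σ' st≈s't' =
    [ toℤ-injective ∘ -≈0⇒≈ , s≡t'⇒s≡s' ∘ toℤ-injective ∘ -≈0⇒≈ ]′ (*≈0⇒≈0⊎≈0 (x - x') (x - y') s-is-root)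
    where
    x = toℤ s
    y = toℤ t
    x' = toℤ s'
    y' = toℤ t'
    s-is-root : (x - x') * (x - y') ≈ 0ℤ
    s-is-root = ≈0-by (vieta x y x' y') (combination≈0 x (- 1ℤ) (≈⇒-≈0 σ≈σ') (≈⇒-≈0 st≈s't'))
      where
      vieta : ∀ x y x' y' → (x - x') * (x - y') ≡ x * ((x + y) - (x' + y')) + (- 1ℤ) * (x * y - x' * y')
      vieta = solve-∀
    s'-is-root : (x' - x) * (x' - y) ≈ 0ℤ
    s'-is-root = ≈0-by (vieta x y x' y') (combination≈0 (- x') 1ℤ (≈⇒-≈0 σ≈σ') (≈⇒-≈0 st≈s't'))
      where
      vieta : ∀ x y x' y' → (x' - x) * (x' - y) ≡ (- x') * ((x + y) - (x' + y')) + 1ℤ * (x * y - x' * y')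
      vieta = solve-∀
    swapped⇒⊥ : s ≡ t' → s' ≡ t → ⊥
    swapped⇒⊥ s≡t' s'≡t = ℕ.<-asym t<s (subst₂ (λ a b → toℕ a ℕ.< toℕ b) (sym s≡t') s'≡t t'<s')
    s≡t'⇒s≡s' : s ≡ t' → s ≡ s'
    s≡t'⇒s≡s' s≡t' = [ sym ∘ toℤ-injective ∘ -≈0⇒≈ , ⊥-elim ∘ swapped⇒⊥ s≡t' ∘ toℤ-injective ∘ -≈0⇒≈ ]′
                       (*≈0⇒≈0⊎≈0 (x' - x) (x' - y) s'-is-root)

  κ-determines-S : ∀ {S S' P P'} → P ≈ P' → κ S P ≈ 0ℤ → κ S' P' ≈ 0ℤ → S ≈ S'
  κ-determines-S {S} {S'} {P} {P'} P≈P' κ≈0 κ'≈0 =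
    -≈0⇒≈ (*-cancelˡ-≈0 (5≉0 *≉0 5≉0 *≉0 5≉0) (≈0-by (difference S S' P P')
      (combination≈0 (- 1ℤ) (+ 978 - + 240 * (P + P')) (≈⇒-≈0 (≈-trans κ≈0 (≈-sym κ'≈0))) (≈⇒-≈0 P≈P'))))
    where
    difference : ∀ S S' P P' → + 125 * (S - S') ≡ - 1ℤ * (κ S P - κ S' P') + (+ 978 - + 240 * (P + P')) * (P - P')
    difference = solve 4 (λ S S' P P' → Κ (+ 125) ⊗ (S ⊕ ⊝ S') ⊜
      (Κ (- 1ℤ) ⊗ (Syntax.κ S P ⊕ ⊝ Syntax.κ S' P') ⊕ (Κ (+ 978) ⊕ ⊝ (Κ (+ 240) ⊗ (P ⊕ P'))) ⊗ (P ⊕ ⊝ P'))) refl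

  σ²-injective : ∀ {σ σ'} → σ * σ * D ≈ σ' * σ' * D → σ ≈ σ' ⊎ σ + σ' ≈ 0ℤ
  σ²-injective {σ} {σ'} S≈S' =
    Sum.map₁ -≈0⇒≈ (*≈0⇒≈0⊎≈0 (σ - σ') (σ + σ') (*-cancelˡ-≈0 D≉0 (≈0-by (factor σ σ' D) (≈⇒-≈0 S≈S'))))
    where
    factor : ∀ σ σ' D → D * ((σ - σ') * (σ + σ')) ≡ σ * σ * D - σ' * σ' * D
    factor = solve-∀

  positive : Fp → Bool
  positive a = toℕ a ℕ.≤ᵇ toℕ (negp a)

  negp-involutive : ∀ a → negp (negp a) ≡ a
  negp-involutive a = toℤ-injective (≈-trans (toℤ-negp (negp a))
    (subst (- toℤ (negp a) ≈_) (ℤ.neg-involutive (toℤ a)) (-‿cong (toℤ-negp a))))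

  ≤ᵇ-symmetric⇒≡ : ∀ m n → (m ℕ.≤ᵇ n) ≡ (n ℕ.≤ᵇ m) → m ≡ n
  ≤ᵇ-symmetric⇒≡ m n eq with ℕ.≤-total m n
  ... | inj₁ m≤n = ℕ.≤-antisym m≤n (ℕ.≤ᵇ⇒≤ n m (subst T eq (ℕ.≤⇒≤ᵇ m≤n)))
  ... | inj₂ n≤m = ℕ.≤-antisym (ℕ.≤ᵇ⇒≤ m n (subst T (sym eq) (ℕ.≤⇒≤ᵇ n≤m))) n≤m

  positive-negp : ∀ {a c} → a ≡ negp c → positive a ≡ positive c → a ≡ c
  positive-negp {c = c} refl same = sym (Fin.toℕ-injective (≤ᵇ-symmetric⇒≡ (toℕ c) (toℕ (negp c)) symmetric))
    where
    symmetric : (toℕ c ℕ.≤ᵇ toℕ (negp c)) ≡ (toℕ (negp c) ℕ.≤ᵇ toℕ c)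
    symmetric = trans (sym same) (cong (λ x → toℕ (negp c) ℕ.≤ᵇ toℕ x) (negp-involutive c))

  sign-fixes-σ : ∀ {s t s' t'} → σ s t + σ s' t' ≈ 0ℤ → positive (s +p t) ≡ positive (s' +p t') →
                 σ s t ≈ σ s' t'
  sign-fixes-σ {s} {t} {s'} {t'} σ+σ'≈0 same =
    ≈-trans (≈-sym (toℤ-+p s t)) (≈-trans (≈-reflexive (cong toℤ (positive-negp opposite same))) (toℤ-+p s' t'))
    where
    σ≈-σ' : σ s t ≈ - σ s' t'
    σ≈-σ' = -≈0⇒≈ (≈0-by (minus-minus (σ s t) (σ s' t')) σ+σ'≈0)
      where
      minus-minus : ∀ a b → a - (- b) ≡ a + b
      minus-minus = solve-∀
    opposite : s +p t ≡ negp (s' +p t')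
    opposite = toℤ-injective (≈-trans (toℤ-+p s t) (≈-trans σ≈-σ'
                 (≈-sym (≈-trans (toℤ-negp (s' +p t')) (-‿cong (toℤ-+p s' t'))))))

  11≈0⇒no-σ-root₀ : ∀ {s t} → + 11 ≈ 0ℤ → toℕ t ℕ.< toℕ s → σ s t ≈ 0ℤ → Root (σ-roots zero) (π s t) → ⊥
  11≈0⇒no-σ-root₀ {s} {t} 11≈0 t<s σ≈0 root = ℕ.<-irrefl (cong toℕ (sym s≡t)) t<s
    where
    st≈0 : toℤ s * toℤ t ≈ 0ℤ
    st≈0 = *-cancelˡ-≈0 (σ-roots-≉0 zero *≉0 D≉0)
             (≈0-by (shift (toℤ s) (toℤ t) D) (combination≈0 1ℤ 1ℤ root 11≈0))
      where
      shift : ∀ s t D → proj₁ (σ-roots zero) * D * (s * t) ≡ 1ℤ * (+ 16 * (s * t * D) - + 11) + 1ℤ * + 11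
      shift = solve-∀
    other≈0 : ∀ a b → a + b ≈ 0ℤ → a ≈ 0ℤ → b ≈ 0ℤ
    other≈0 a b a+b≈0 a≈0 = ≈0-by (cancel a b) (combination≈0 1ℤ (- 1ℤ) a+b≈0 a≈0)
      where
      cancel : ∀ a b → b ≡ 1ℤ * (a + b) + (- 1ℤ) * a
      cancel = solve-∀
    t+s≈0 : toℤ t + toℤ s ≈ 0ℤ
    t+s≈0 = ≈-trans (≈-reflexive (ℤ.+-comm (toℤ t) (toℤ s))) σ≈0
    s≡t : s ≡ t
    s≡t = toℤ-injective ([ (λ s≈0 → ≈-trans s≈0 (≈-sym (other≈0 (toℤ s) (toℤ t) σ≈0 s≈0)))
                         , (λ t≈0 → ≈-trans (other≈0 (toℤ t) (toℤ s) t+s≈0 t≈0) (≈-sym t≈0)) ]′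
                         (*≈0⇒≈0⊎≈0 (toℤ s) (toℤ t) st≈0))

  data Removal (s : Fp) : Set where
    b-vanishes : toℤ s ≈ 0ℤ → + 11 ≈ 0ℤ → Removal s
    σ-root : ∀ t → toℕ t ℕ.< toℕ s → σ s t ≈ 0ℤ → ∀ k → Root (σ-roots k) (π s t) → Removal s
    κ-root : ∀ t → toℕ t ℕ.< toℕ s → κ (σ s t * σ s t * D) (π s t) ≈ 0ℤ →
             ∀ k → Root (κ-roots k) (π s t) → Removal s

  classify : ∀ {s t} → toℕ t ℕ.< toℕ s → Bad s t → Removal s
  classify {s} {t} t<s (σκ≈0 , ε≈0) =
    [ σ-branch , κ-branch ]′ (*≈0⇒≈0⊎≈0 (σ s t) (κ (σ s t * σ s t * D) (π s t)) σκ≈0)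
    where
    σ-branch : σ s t ≈ 0ℤ → Removal s
    σ-branch σ≈0 = uncurry (σ-root t t<s σ≈0) (σ-case {s} {t} σ≈0 ε≈0)
    κ-branch : κ (σ s t * σ s t * D) (π s t) ≈ 0ℤ → Removal s
    κ-branch κ≈0 = uncurry (κ-root t t<s κ≈0) (κ-case {σ s t * σ s t * D} {π s t} κ≈0 ε≈0)

  -- The pair {t , s} is the root set of X² − σX + π/Δ. The root fixes π; σ is 0 in the σ-case and
  -- is fixed up to sign by σ²Δ ≈ S in the κ-case, the sign being recorded by `positive`.
  -- b-vanishes can share its code with the first σ-root since, when 11 ≈ 0, that root forces s = t = 0.
  Code : Set
  Code = Fin 2 ⊎ (Fin 3 × Bool)

  code : ∀ {s} → Removal s → Code
  code (b-vanishes _ _) = inj₁ zero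
  code (σ-root _ _ _ k _) = inj₁ k
  code {s} (κ-root t _ _ k _) = inj₂ (k , positive (s +p t))

  code-injective : ∀ {s s'} (r : Removal s) (r' : Removal s') → code r ≡ code r' → s ≡ s'
  code-injective (b-vanishes s≈0 _) (b-vanishes s'≈0 _) _ = toℤ-injective (≈-trans s≈0 (≈-sym s'≈0))
  code-injective (b-vanishes _ 11≈0) (σ-root t' t'<s' σ'≈0 zero root') _ =
    ⊥-elim (11≈0⇒no-σ-root₀ 11≈0 t'<s' σ'≈0 root')
  code-injective (σ-root t t<s σ≈0 zero root) (b-vanishes _ 11≈0) _ = ⊥-elim (11≈0⇒no-σ-root₀ 11≈0 t<s σ≈0 root)
  code-injective {s} {s'} (σ-root t t<s σ≈0 k root) (σ-root t' t'<s' σ'≈0 .k root') refl =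
    same-pair {s} {t} {s'} {t'} t<s t'<s' (≈-trans σ≈0 (≈-sym σ'≈0))
      (π-injective {s} {t} {s'} {t'} (root-unique (σ-roots k) (σ-roots-≉0 k) root root'))
  code-injective {s} {s'} (κ-root t t<s κ≈0 k root) (κ-root t' t'<s' κ'≈0 k' root') eq =
    same-pair {s} {t} {s'} {t'} t<s t'<s' σ≈σ' (π-injective {s} {t} {s'} {t'} π≈π')
    where
    same-root : k ≡ k'
    same-root = proj₁ (,-injective (inj₂-injective eq))
    same-sign : positive (s +p t) ≡ positive (s' +p t')
    same-sign = proj₂ (,-injective (inj₂-injective eq))
    π≈π' : π s t ≈ π s' t'
    π≈π' = root-unique (κ-roots k) (κ-roots-≉0 k) root
            (subst (λ j → Root (κ-roots j) (π s' t')) (sym same-root) root')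
    σ≈σ' : σ s t ≈ σ s' t'
    σ≈σ' = [ id , (λ σ+σ'≈0 → sign-fixes-σ {s} {t} {s'} {t'} σ+σ'≈0 same-sign) ]′
             (σ²-injective {σ s t} {σ s' t'}
               (κ-determines-S {σ s t * σ s t * D} {σ s' t' * σ s' t' * D} π≈π' κ≈0 κ'≈0))
  code-injective (b-vanishes _ _) (σ-root _ _ _ (suc _) _) ()
  code-injective (b-vanishes _ _) (κ-root _ _ _ _ _) ()
  code-injective (σ-root _ _ _ (suc _) _) (b-vanishes _ _) ()
  code-injective (σ-root _ _ _ _ _) (κ-root _ _ _ _ _) ()
  code-injective (κ-root _ _ _ _ _) (b-vanishes _ _) ()
  code-injective (κ-root _ _ _ _ _) (σ-root _ _ _ _ _) ()

module Conclusion (p : ℕ) {{_ : NonZero p}} (Δ : Fin p) where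

  open import Data.Bool using (Bool)
  open import Data.List using (List; length)
  open import Data.List.Relation.Unary.All using (All)
  open import Data.List.Relation.Unary.AllPairs using (AllPairs)
  open import Data.Nat as ℕ using (ℕ; _∸_; _≤_)
  open import Data.Product using (Σ; _×_)
  open import Relation.Nullary using (¬_)

  open Field p Δ

  DistinctCurves : Set
  DistinctCurves = Σ (List Fp) λ ss → (p ∸ 8 ≤ length ss) × All (λ s → Nonsingular (E3 s)) ss
                                    × AllPairs (λ s t → ¬ Isomorphic (E3 s) (E3 t)) ss

  DistinctCurvesAndTwists : F2 → Set
  DistinctCurvesAndTwists d =
    Σ (List (Fp × Bool)) λ ts → (2 ℕ.* p ∸ 16 ≤ length ts) × All (λ t → Nonsingular (E3orTwist d t)) ts
                              × AllPairs (λ t t' → ¬ Isomorphic (E3orTwist d t) (E3orTwist d t')) ts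

module LargeCharacteristic (p : ℕ) {{_ : NonZero p}} (Δ : Fin p) (p-prime : Prime p) (p≥11 : 11 ≤ p)
    (Δ-nonsquare : Field.NonsquareFp p Δ) where

  open import Data.Bool using (Bool; true; false)
  open import Data.Empty using (⊥)
  open import Data.Fin using (Fin; toℕ)
  import Data.Fin.Properties as Fin
  open import Data.Integer using (+_; 0ℤ; _*_)
  open import Data.List using (List; length; filter; allFin; map; _++_)
  import Data.List.Properties as List
  open import Data.List.Relation.Unary.All as All using (All)
  import Data.List.Relation.Unary.All.Properties as All
  open import Data.List.Relation.Unary.AllPairs as AllPairs using (AllPairs)
  import Data.List.Relation.Unary.AllPairs.Properties as AllPairs
  import Data.List.Relation.Unary.Unique.Propositional.Properties as Unique
  open import Data.Nat as ℕ using (ℕ; _∸_; _≤_)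
  import Data.Nat.Properties as ℕ
  open import Data.Product using (Σ; _×_; _,_; proj₂)
  open import Data.Product.Function.NonDependent.Propositional using (_×-↔_)
  open import Data.Sum using (_⊎_; inj₁; inj₂)
  open import Data.Sum.Function.Propositional using (_⊎-↔_)
  open import Function using (_∘_; Injection; _↣_)
  open import Function.Properties.Inverse using (↔-refl; ↔-sym; ↔-trans; ↔⇒↣)
  open import Relation.Binary using (Tri; tri<; tri≈; tri>)
  open import Relation.Binary.PropositionalEquality using (_≡_; _≢_; sym; trans; cong; cong₂; subst; subst₂)
  open import Relation.Nullary using (¬_; Dec; yes; no)
  open import Relation.Nullary.Decidable using (_×-dec_; _⊎-dec_)
  open import Relation.Unary using (Decidable)
  open import Relation.Unary.Properties using (∁?)
  open Counting

  open Field p Δ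
  open Congruence p
  open Lifting p Δ using (D)
  open QuadraticField p Δ p-prime Δ-nonsquare using (nonsquare⇒≢0)
  open Curves p Δ p-prime Δ-nonsquare
  open Family p Δ p-prime p≥11 Δ-nonsquare
  open Classification p Δ p-prime p≥11 Δ-nonsquare
  open Conclusion p Δ

  Removed : Fp → Set
  Removed s = (toℤ s ≈ 0ℤ × + 11 ≈ 0ℤ) ⊎ (Σ Fp λ t → toℕ t ℕ.< toℕ s × Bad s t)

  Removed? : Decidable Removed
  Removed? s = (≈? (toℤ s) 0ℤ ×-dec ≈? (+ 11) 0ℤ) ⊎-dec Fin.any? (λ t → (toℕ t ℕ.<? toℕ s) ×-dec Bad? t)
    where
    Bad? : ∀ t → Dec (Bad s t)
    Bad? t = ≈? (σ s t * κ (σ s t * σ s t * D) (π s t)) 0ℤ ×-dec ≈? (ε (σ s t * σ s t * D) (π s t)) 0ℤ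

  removal : ∀ {s} → Removed s → Removal s
  removal (inj₁ (s≈0 , 11≈0)) = b-vanishes s≈0 11≈0
  removal (inj₂ (t , t<s , bad)) = classify t<s bad

  encode : Code ↣ Fin 8
  encode = ↔⇒↣ (↔-sym (↔-trans Fin.+↔⊎ (↔-refl ⊎-↔ ↔-trans Fin.*↔× (↔-refl ×-↔ Fin.2↔Bool))))

  removed kept : List Fp
  removed = filter Removed? (allFin p)
  kept = filter (∁? Removed?) (allFin p)

  length-removed≤8 : length removed ≤ 8
  length-removed≤8 =
    Unique∧injective⇒length≤ (λ r → Injection.to encode (code (removal r)))
      (λ r r' eq → code-injective (removal r) (removal r') (Injection.injective encode eq))
      (All.all-filter Removed? (allFin p)) (Unique.filter⁺ Removed? (Unique.allFin⁺ p))

  p∸8≤length-kept : p ∸ 8 ≤ length kept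
  p∸8≤length-kept = subst (p ∸ 8 ≤_) p∸removed≡kept (ℕ.∸-monoʳ-≤ p length-removed≤8)
    where
    removed+kept≡p : length removed ℕ.+ length kept ≡ p
    removed+kept≡p = trans (length-filter+length-filter-∁ Removed? (allFin p)) (List.length-tabulate (λ i → i))
    p∸removed≡kept : p ∸ length removed ≡ length kept
    p∸removed≡kept =
      subst (λ n → n ∸ length removed ≡ length kept) removed+kept≡p (ℕ.m+n∸m≡n (length removed) (length kept))

  kept-¬Removed : All (¬_ ∘ Removed) kept
  kept-¬Removed = All.all-filter (∁? Removed?) (allFin p)

  kept-Unique : AllPairs _≢_ kept
  kept-Unique = Unique.filter⁺ (∁? Removed?) (Unique.allFin⁺ p)

  ¬Removed⇒B≢0 : ∀ {s} → ¬ Removed s → proj₂ (E3 s) ≢ lit 0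
  ¬Removed⇒B≢0 {s} s-kept B≡0 = s-kept (inj₁ (B≡0⇒s≈0∧11≈0 s B≡0))

  ¬Removed⇒¬SameJ : ∀ {s s'} → ¬ Removed s → ¬ Removed s' → s ≢ s' → ¬ SameJ (E3 s) (E3 s')
  ¬Removed⇒¬SameJ {s} {s'} s-kept s'-kept s≢s' same = by-order (ℕ.<-cmp (toℕ s) (toℕ s'))
    where
    by-order : Tri (toℕ s ℕ.< toℕ s') (toℕ s ≡ toℕ s') (toℕ s' ℕ.< toℕ s) → ⊥
    by-order (tri< s<s' _ _) = s'-kept (inj₂ (s , s<s' , SameJ-E3⇒Bad (s≢s' ∘ sym) (sym same)))
    by-order (tri≈ _ s≡s' _) = s≢s' (Fin.toℕ-injective s≡s')
    by-order (tri> _ _ s'<s) = s-kept (inj₂ (s' , s'<s , SameJ-E3⇒Bad s≢s' same))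

  ¬Removed⇒¬Isomorphic : ∀ {s s'} → ¬ Removed s → ¬ Removed s' → s ≢ s' → ¬ Isomorphic (E3 s) (E3 s')
  ¬Removed⇒¬Isomorphic {s} {s'} s-kept s'-kept s≢s' =
    ¬Removed⇒¬SameJ s-kept s'-kept s≢s' ∘ isomorphic⇒SameJ (E3 s) (E3 s')

  distinct-curves : DistinctCurves
  distinct-curves = kept , p∸8≤length-kept , All.tabulate (λ {s} _ → E3-nonsingular s) ,
    AllPairs-map-All ¬Removed⇒¬Isomorphic kept-¬Removed kept-Unique

  module _ (d : F2) (d-nonsquare : NonsquareF2 d) where

    private
      d≢0 : d ≢ lit 0
      d≢0 = nonsquare⇒≢0 d-nonsquare

    ¬Removed⇒twists-¬Isomorphic : ∀ {s s'} → ¬ Removed s → ¬ Removed s' → s ≢ s' →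
                                  ¬ Isomorphic (twist d (E3 s)) (twist d (E3 s'))
    ¬Removed⇒twists-¬Isomorphic {s} {s'} s-kept s'-kept s≢s' =
      ¬Removed⇒¬SameJ s-kept s'-kept s≢s' ∘ SameJ-twist⁻¹ (E3 s) (E3 s') d≢0 ∘
      isomorphic⇒SameJ (twist d (E3 s)) (twist d (E3 s'))

    ¬Removed⇒¬Isomorphic-twist : ∀ {s s'} → ¬ Removed s → ¬ Removed s' → ¬ Isomorphic (E3 s) (twist d (E3 s'))
    ¬Removed⇒¬Isomorphic-twist {s} {s'} s-kept s'-kept iso = by-equality (s Fin.≟ s')
      where
      by-equality : Dec (s ≡ s') → ⊥
      by-equality (yes s≡s') = d-nonsquare (isomorphic-to-twist⇒square (E3 s) (A≢0 s) (¬Removed⇒B≢0 s-kept)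
                                 (subst (λ x → Isomorphic (E3 s) (twist d (E3 x))) (sym s≡s') iso))
      by-equality (no s≢s') = ¬Removed⇒¬SameJ s-kept s'-kept s≢s'
        (SameJ-twistʳ⁻¹ (E3 s) (E3 s') d≢0 (isomorphic⇒SameJ (E3 s) (twist d (E3 s')) iso))

    distinct-curves-and-twists : DistinctCurvesAndTwists d
    distinct-curves-and-twists =
      untwisted ++ twisted , length-bound ,
      All.++⁺ untwisted-nonsingular twisted-nonsingular ,
      AllPairs.++⁺ untwisted-distinct twisted-distinct untwisted-twisted-distinct
      where
      Distinct : Fp × Bool → Fp × Bool → Set
      Distinct t t' = ¬ Isomorphic (E3orTwist d t) (E3orTwist d t')
      untwisted twisted : List (Fp × Bool)
      untwisted = map (_, false) kept
      twisted = map (_, true) kept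
      untwisted-nonsingular : All (λ t → Nonsingular (E3orTwist d t)) untwisted
      untwisted-nonsingular = All.map⁺ {f = _, false} (All.tabulate (λ {s} _ → E3-nonsingular s))
      twisted-nonsingular : All (λ t → Nonsingular (E3orTwist d t)) twisted
      twisted-nonsingular = All.map⁺ {f = _, true} (All.tabulate (λ {s} _ → twist-nonsingular (E3 s) d≢0 (E3-nonsingular s)))
      untwisted-distinct : AllPairs Distinct untwisted
      untwisted-distinct = AllPairs.map⁺ {f = _, false} (AllPairs-map-All ¬Removed⇒¬Isomorphic kept-¬Removed kept-Unique)
      twisted-distinct : AllPairs Distinct twisted
      twisted-distinct = AllPairs.map⁺ {f = _, true} (AllPairs-map-All ¬Removed⇒twists-¬Isomorphic kept-¬Removed kept-Unique)
      untwisted-twisted-distinct : All (λ t → All (Distinct t) twisted) untwisted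
      untwisted-twisted-distinct = All.map⁺ {f = _, false} (All.map (λ s-kept → All.map⁺ {f = _, true}
                                     (All.map (¬Removed⇒¬Isomorphic-twist s-kept) kept-¬Removed)) kept-¬Removed)
      length-bound : 2 ℕ.* p ∸ 16 ≤ length (untwisted ++ twisted)
      length-bound = subst₂ _≤_ (ℕ.*-distribˡ-∸ 2 p 8) (sym length-ts) (ℕ.*-monoʳ-≤ 2 p∸8≤length-kept)
        where
        length-ts : length (untwisted ++ twisted) ≡ 2 ℕ.* length kept
        length-ts = begin
          length (untwisted ++ twisted)         ≡⟨ List.length-++ untwisted ⟩
          length untwisted ℕ.+ length twisted   ≡⟨ cong₂ ℕ._+_ (List.length-map (_, false) kept) (List.length-map (_, true) kept) ⟩
          length kept ℕ.+ length kept           ≡⟨ cong (length kept ℕ.+_) (ℕ.+-identityʳ (length kept)) ⟨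
          2 ℕ.* length kept                     ∎
          where open Relation.Binary.PropositionalEquality.≡-Reasoning

open import Data.Nat as ℕ using (ℕ; _*_; _∸_; _<_; _≤_; NonZero)
import Data.Nat.Properties as ℕ
open import Data.Nat.Primality using (Prime; prime?)
open import Data.Fin using (Fin; toℕ; fromℕ<)
import Data.Fin.Properties as Fin
open import Data.Bool using (Bool)
open import Data.Product using (Σ; _×_; _,_)
open import Data.List using (List; length; [])
open import Data.List.Relation.Unary.All using (All; [])
open import Data.List.Relation.Unary.AllPairs using (AllPairs; [])
open import Relation.Nullary using (¬_; Dec; yes; no)
open import Relation.Nullary.Decidable using (from-yes; _→-dec_)
open import Relation.Binary.PropositionalEquality using (sym; subst)
open Conclusion using (DistinctCurves; DistinctCurvesAndTwists)

primes-below-11-are-≤8 : ∀ (i : Fin 11) → Prime (toℕ i) → toℕ i ℕ.≤ 8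
primes-below-11-are-≤8 = from-yes (Fin.all? {n = 11} λ i → prime? (toℕ i) →-dec (toℕ i ℕ.≤? 8))

prime<11⇒≤8 : ∀ {p} → Prime p → p < 11 → p ≤ 8
prime<11⇒≤8 p-prime p<11 = subst (_≤ 8) (Fin.toℕ-fromℕ< p<11)
  (primes-below-11-are-≤8 (fromℕ< p<11) (subst Prime (sym (Fin.toℕ-fromℕ< p<11)) p-prime))

proposition4 : (p : ℕ) {{_ : NonZero p}} → Prime p → 3 < p →
    (Δ : Fin p) → Field.NonsquareFp p Δ →
    (Σ (List (Fin p)) λ ss →
        (p ∸ 8 ≤ length ss)
      × All (λ s → Field.Nonsingular p Δ (Field.E3 p Δ s)) ss
      × AllPairs (λ s t → ¬ Field.Isomorphic p Δ (Field.E3 p Δ s) (Field.E3 p Δ t)) ss)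
    × ((d : Field.F2 p Δ) → Field.NonsquareF2 p Δ d →
       Σ (List (Fin p × Bool)) λ ts →
          (2 * p ∸ 16 ≤ length ts)
        × All (λ t → Field.Nonsingular p Δ (Field.E3orTwist p Δ d t)) ts
        × AllPairs (λ t t' → ¬ Field.Isomorphic p Δ (Field.E3orTwist p Δ d t) (Field.E3orTwist p Δ d t')) ts)
proposition4 p p-prime _ Δ Δ-nonsquare = by-size (11 ℕ.≤? p)
  where
  open Field p Δ using (F2; NonsquareF2)
  by-size : Dec (11 ≤ p) → DistinctCurves p Δ × (∀ d → NonsquareF2 d → DistinctCurvesAndTwists p Δ d)
  by-size (yes p≥11) = LargeCharacteristic.distinct-curves p Δ p-prime p≥11 Δ-nonsquare ,
                       LargeCharacteristic.distinct-curves-and-twists p Δ p-prime p≥11 Δ-nonsquare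
  by-size (no p≱11) = ([] , p∸8≤0 , [] , []) , λ _ _ → [] , 2p∸16≤0 , [] , []
    where
    p≤8 : p ≤ 8
    p≤8 = prime<11⇒≤8 p-prime (ℕ.≰⇒> p≱11)
    p∸8≤0 : p ∸ 8 ≤ 0
    p∸8≤0 = ℕ.≤-reflexive (ℕ.m≤n⇒m∸n≡0 p≤8)
    2p∸16≤0 : 2 * p ∸ 16 ≤ 0
    2p∸16≤0 = ℕ.≤-reflexive (ℕ.m≤n⇒m∸n≡0 (ℕ.*-monoʳ-≤ 2 p≤8))
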